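{- Let $G$ be a connected, biconnected, 3-regular series-parallel graph (multiple edges allowed, no self-loops). Then there exist vertices $p,q\in V_G$ such that the two-terminal series-parallel graph $(G,p,q)$ is obtainable from $(D_3,p,q)$ by a finite sequence of applications of the operation $\tau$.
   Context: Graphs are connected and without self-loops; multi-edges are allowed. The dipole $D_n$ is the graph with two vertices joined by $n$ parallel edges; $(D_3,p,q)$ denotes $D_3$ with its two vertices designated as roots $p$ and $q$. The operation $\tau$ (a "dmt-step", double the middle third) on a graph: choose an arbitrary edge $e$, subdivide it by two new vertices into three consecutive edges, and add a new edge parallel to the middle one of these three edges (joining the two new vertices); the roots are unchanged. A two-terminal series-parallel graph is a graph $G$ with two distinguished vertices $(G,p,q)$ (source root $p$, target root $q$) defined recursively: $(K_2,p,q)$, where $p,q$ are the two vertices of $K_2$, is two-terminal series-parallel; if $(G,p,q)$ and $(G',p',q')$ are two-terminal series-parallel, then so is their series composition (identify $q$ with $p'$; the new roots are $p$ and $q'$) and their parallel composition (identify $p$ with $p'$ and $q$ with $q'$; the new roots are the merged vertices). A graph $G$ is series-parallel if there exist vertices $p,q$ of $G$ such that $(G,p,q)$ is a two-terminal series-parallel graph. -}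

module Defs where

open import Data.Nat using (ℕ; zero; suc; _+_)
open import Data.Fin using (Fin; zero; suc; _↑ˡ_; _↑ʳ_; _≟_)
open import Data.List using (List; map; allFin)
open import Data.Nat.ListAction using (sum)
open import Data.Product using (Σ; ∃; _×_; _,_; proj₁; proj₂)
open import Data.Sum using (_⊎_)
open import Data.Unit using (⊤)
open import Relation.Nullary using (¬_; Dec; yes; no)
open import Relation.Binary.PropositionalEquality using (_≡_; _≢_)
open import Function.Bundles using (_↔_; Inverse)

-- Finite multigraphs: vertices Fin n, edges Fin m, each edge has an
-- (arbitrarily oriented) pair of end vertices.  Parallel edges are allowed.
-- Looplessness is a separate predicate.

record Graph : Set where
  field
    n    : ℕ
    m    : ℕ
    ends : Fin m → Fin n × Fin n
open Graph public

Loopless : Graph → Set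
Loopless G = ∀ e → proj₁ (ends G e) ≢ proj₂ (ends G e)

Joins : (G : Graph) → Fin (m G) → Fin (n G) → Fin (n G) → Set
Joins G e u w = (ends G e ≡ (u , w)) ⊎ (ends G e ≡ (w , u))

data Walk (G : Graph) (ok : Fin (n G) → Set) : Fin (n G) → Fin (n G) → Set where
  here : ∀ {u} → ok u → Walk G ok u u
  step : ∀ {u w v} (e : Fin (m G)) → Joins G e u w → ok u → Walk G ok w v → Walk G ok u v

Connected : Graph → Set
Connected G = ∀ u v → Walk G (λ _ → ⊤) u v

Biconnected : Graph → Set
Biconnected G = Connected G ×
  (∀ x u v → u ≢ x → v ≢ x → Walk G (λ w → w ≢ x) u v)

indicator : ∀ {A : Set} → Dec A → ℕ
indicator (yes _) = 1
indicator (no _)  = 0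

degree : (G : Graph) → Fin (n G) → ℕ
degree G v = sum (map (λ e → indicator (proj₁ (ends G e) ≟ v)
                            + indicator (proj₂ (ends G e) ≟ v)) (allFin (m G)))

Cubic : Graph → Set
Cubic G = ∀ v → degree G v ≡ 3

record RGraph : Set where
  field
    graph : Graph
    src   : Fin (n graph)
    tgt   : Fin (n graph)
open RGraph public

record _≅_ (A B : RGraph) : Set where
  field
    vmap  : Fin (n (graph A)) ↔ Fin (n (graph B))
    emap  : Fin (m (graph A)) ↔ Fin (m (graph B))
    ends-pres : ∀ e →
      Joins (graph B) (Inverse.to emap e)
        (Inverse.to vmap (proj₁ (ends (graph A) e)))
        (Inverse.to vmap (proj₂ (ends (graph A) e)))
    src-pres : Inverse.to vmap (src A) ≡ src B
    tgt-pres : Inverse.to vmap (tgt A) ≡ tgt B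

-- In the built graph the source is vertex 0 and
-- the target is vertex 1; the other (internal) vertices follow.

data SPTree : Set where
  K2  : SPTree
  ser : SPTree → SPTree → SPTree   -- series: target of left = source of right
  par : SPTree → SPTree → SPTree

internal : SPTree → ℕ
internal K2 = 0
internal (ser s t) = suc (internal s + internal t)
internal (par s t) = internal s + internal t

nedges : SPTree → ℕ
nedges K2 = 1
nedges (ser s t) = nedges s + nedges t
nedges (par s t) = nedges s + nedges t

map2 : ∀ {A B : Set} → (A → B) → A × A → B × B
map2 f (a , b) = f a , f b

serL : ∀ k1 k2 → Fin (suc (suc k1)) → Fin (suc (suc (suc (k1 + k2))))
serL k1 k2 zero = zero
serL k1 k2 (suc zero) = suc (suc zero)
serL k1 k2 (suc (suc i)) = suc (suc (suc (i ↑ˡ k2)))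

serR : ∀ k1 k2 → Fin (suc (suc k2)) → Fin (suc (suc (suc (k1 + k2))))
serR k1 k2 zero = suc (suc zero)
serR k1 k2 (suc zero) = suc zero
serR k1 k2 (suc (suc i)) = suc (suc (suc (k1 ↑ʳ i)))

parL : ∀ k1 k2 → Fin (suc (suc k1)) → Fin (suc (suc (k1 + k2)))
parL k1 k2 zero = zero
parL k1 k2 (suc zero) = suc zero
parL k1 k2 (suc (suc i)) = suc (suc (i ↑ˡ k2))

parR : ∀ k1 k2 → Fin (suc (suc k2)) → Fin (suc (suc (k1 + k2)))
parR k1 k2 zero = zero
parR k1 k2 (suc zero) = suc zero
parR k1 k2 (suc (suc i)) = suc (suc (k1 ↑ʳ i))

joinEnds : ∀ {a b : ℕ} {A : Set} → (Fin a → A) → (Fin b → A) → Fin (a + b) → A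
joinEnds {a} {b} f g e with Data.Fin.splitAt a e
... | Data.Sum.inj₁ i = f i
... | Data.Sum.inj₂ j = g j

spEnds : (t : SPTree) → Fin (nedges t) → Fin (suc (suc (internal t))) × Fin (suc (suc (internal t)))
spEnds K2 zero = zero , suc zero
spEnds (ser s t) = joinEnds (λ e → map2 (serL (internal s) (internal t)) (spEnds s e))
                                  (λ e → map2 (serR (internal s) (internal t)) (spEnds t e))
spEnds (par s t) = joinEnds (λ e → map2 (parL (internal s) (internal t)) (spEnds s e))
                                  (λ e → map2 (parR (internal s) (internal t)) (spEnds t e))

spGraph : SPTree → RGraph
spGraph t = record
  { graph = record { n = suc (suc (internal t)) ; m = nedges t ; ends = spEnds t }
  ; src = zero ; tgt = suc zero }

IsTTSP : RGraph → Set
IsTTSP R = ∃ λ t → spGraph t ≅ R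

rooted : (G : Graph) → Fin (n G) → Fin (n G) → RGraph
rooted G p q = record { graph = G ; src = p ; tgt = q }

SeriesParallel : Graph → Set
SeriesParallel G = Σ (Fin (n G)) λ p → Σ (Fin (n G)) λ q → IsTTSP (rooted G p q)

D3 : RGraph
D3 = record
  { graph = record { n = 2 ; m = 3 ; ends = λ _ → zero , suc zero }
  ; src = zero ; tgt = suc zero }

tauGraph : (G : Graph) → Fin (m G) → Graph
tauGraph G e = record { n = n G + 2 ; m = m G + 3 ; ends = newEnds }
  where
    old : Fin (n G) → Fin (n G + 2)
    old v = v ↑ˡ 2
    a b : Fin (n G + 2)
    a = n G ↑ʳ zero
    b = n G ↑ʳ suc zero
    oldEnds : Fin (m G) → Fin (n G + 2) × Fin (n G + 2)
    oldEnds f with f ≟ e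
    ... | yes _ = old (proj₁ (ends G e)) , a
    ... | no _  = map2 old (ends G f)
    extra : Fin 3 → Fin (n G + 2) × Fin (n G + 2)
    extra zero = a , b
    extra (suc zero) = a , b
    extra (suc (suc _)) = b , old (proj₂ (ends G e))
    newEnds : Fin (m G + 3) → Fin (n G + 2) × Fin (n G + 2)
    newEnds = joinEnds oldEnds extra

tau : (R : RGraph) → Fin (m (graph R)) → RGraph
tau R e = record { graph = tauGraph (graph R) e
                 ; src = src R ↑ˡ 2 ; tgt = tgt R ↑ˡ 2 }

data TauReachable : RGraph → Set where
  start : TauReachable D3
  step  : ∀ {R} → TauReachable R → (e : Fin (m (graph R))) → TauReachable (tau R e)

ObtainableFromD3 : RGraph → Set
ObtainableFromD3 R = ∃ λ H → TauReachable H × (H ≅ R)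

-- Take a series-parallel decomposition tree t of G. Biconnectivity rules out a series composition at
-- the top (its junction would be a cut vertex), so t = par a b. Cubicity forces every proper subtree
-- to have root degrees 1 or 2 and every series junction to split 3 as 1 + 2 or 2 + 1. A subtree with
-- root degrees (1, 1) is then, up to isomorphism, grown: g ::= K₂ | ser g (ser (par g g) g). A dmt-step
-- replaces an edge by ser K₂ (ser (par K₂ K₂) K₂), so every grown tree is obtainable from K₂. Going
-- through the possible root degrees of a and b, and re-rooting G at a series junction where needed,
-- G becomes par g₁ (par g₂ g₃) with g₁, g₂, g₃ grown, which is obtained by growing the three edges of
-- D₃ = par K₂ (par K₂ K₂).

module Submission where

open import Defs

import Data.Nat.Properties as ℕ
open import Algebra.Properties.CommutativeMonoid.Sum ℕ.+-0-commutativeMonoid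
  using (sum-cong-≗; sum-replicate-zero; sum-permute) renaming (sum to ∑)
open import Data.Bool using (Bool; true; false)
open import Data.Empty using (⊥; ⊥-elim)
open import Data.Fin using (Fin; zero; suc; _↑ˡ_; _↑ʳ_; join; splitAt; _≟_)
open import Data.Fin.Properties
  using (0↔⊥; 1↔⊤; +↔⊎; splitAt-↑ˡ; splitAt-↑ʳ; splitAt⁻¹-↑ˡ; splitAt⁻¹-↑ʳ; suc-injective; ↑ˡ-injective; ↑ʳ-injective)
open import Data.List using (tabulate)
open import Data.List.Properties using (map-tabulate)
open import Data.Nat using (ℕ; zero; suc; _+_; _≤_)
open import Data.Nat.ListAction using () renaming (sum to sumᴸ)
open import Data.Product using (Σ; _×_; _,_; proj₁; proj₂; swap)
open import Data.Sum using (_⊎_; inj₁; inj₂; [_,_])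
open import Data.Sum.Algebra using (⊎-cong; ⊎-assoc)
open import Data.Sum.Properties using (swap-↔; ≡-dec)
open import Data.Unit using (⊤; tt) renaming (_≟_ to _≟⊤_)
open import Function using (_∘_; id; _↔_; Inverse; mk↔ₛ′; Injection; Injective)
open import Function.Properties.Inverse using (↔-refl; ↔-sym; ↔-trans; ↔⇒↣)
open import Level using (0ℓ)
open import Relation.Binary.Construct.Closure.ReflexiveTransitive using (Star; ε; _◅_; _◅◅_; gmap)
open import Relation.Binary.Definitions using (DecidableEquality)
open import Relation.Binary.PropositionalEquality
  using (_≡_; _≢_; refl; sym; trans; cong; cong₂; subst₂; _≗_; module ≡-Reasoning)
import Relation.Binary.Reasoning.Base.Single
open import Relation.Nullary using (¬_; yes; no)

open Inverse using (to; from; strictlyInverseˡ; strictlyInverseʳ)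

private variable
  U V W X : Set

infix 4 _≐_
_≐_ : V × V → V × V → Set
p ≐ q = p ≡ q ⊎ p ≡ swap q

≐-sym : {p q : V × V} → p ≐ q → q ≐ p
≐-sym (inj₁ refl) = inj₁ refl
≐-sym (inj₂ refl) = inj₂ refl

≐-trans : {p q r : V × V} → p ≐ q → q ≐ r → p ≐ r
≐-trans (inj₁ refl) q≐r = q≐r
≐-trans (inj₂ refl) (inj₁ refl) = inj₂ refl
≐-trans (inj₂ refl) (inj₂ refl) = inj₁ refl

≐-map : (f : V → W) {p q : V × V} → p ≐ q → map2 f p ≐ map2 f q
≐-map f (inj₁ refl) = inj₁ refl
≐-map f (inj₂ refl) = inj₂ refl

map2-cong : {f g : V → W} → f ≗ g → ∀ p → map2 f p ≡ map2 g p
map2-cong f≗g (a , b) = cong₂ _,_ (f≗g a) (f≗g b)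

↔-injective : (f : V ↔ W) {x y : V} → to f x ≡ to f y → x ≡ y
↔-injective f = Injection.injective (↔⇒↣ f)

-- Graphs on arbitrary vertex and edge types: compositions and τ become sums of types, so that the
-- identities between them hold by computation.
record Rooted : Set₁ where
  field
    Vert Edge   : Set
    endsᴿ       : Edge → Vert × Vert
    root₀ root₁ : Vert
open Rooted

infix 4 _≃_
record _≃_ (G H : Rooted) : Set where
  field
    vert↔      : Vert G ↔ Vert H
    edge↔      : Edge G ↔ Edge H
    endsᴿ-pres : ∀ e → endsᴿ H (to edge↔ e) ≐ map2 (to vert↔) (endsᴿ G e)
    root₀-pres : to vert↔ (root₀ G) ≡ root₀ H
    root₁-pres : to vert↔ (root₁ G) ≡ root₁ H
open _≃_

≃-refl : {G : Rooted} → G ≃ G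
≃-refl = record { vert↔ = ↔-refl ; edge↔ = ↔-refl ; endsᴿ-pres = λ _ → inj₁ refl
                ; root₀-pres = refl ; root₁-pres = refl }

≃-sym : {G H : Rooted} → G ≃ H → H ≃ G
≃-sym {G} {H} f = record
  { vert↔ = ↔-sym (vert↔ f) ; edge↔ = ↔-sym (edge↔ f) ; endsᴿ-pres = pres
  ; root₀-pres = back (root₀-pres f) ; root₁-pres = back (root₁-pres f) }
  where
  back : ∀ {v w} → to (vert↔ f) v ≡ w → from (vert↔ f) w ≡ v
  back refl = strictlyInverseʳ (vert↔ f) _
  pres : ∀ e → endsᴿ G (from (edge↔ f) e) ≐ map2 (from (vert↔ f)) (endsᴿ H e)
  pres e = ≐-trans (inj₁ (sym (map2-cong (strictlyInverseʳ (vert↔ f)) (endsᴿ G e′))))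
             (≐-map (from (vert↔ f)) (≐-sym (≐-trans
               (inj₁ (cong (endsᴿ H) (sym (strictlyInverseˡ (edge↔ f) e)))) (endsᴿ-pres f e′))))
    where e′ = from (edge↔ f) e

≃-trans : {G H K : Rooted} → G ≃ H → H ≃ K → G ≃ K
≃-trans f g = record
  { vert↔ = ↔-trans (vert↔ f) (vert↔ g) ; edge↔ = ↔-trans (edge↔ f) (edge↔ g)
  ; endsᴿ-pres = λ e → ≐-trans (endsᴿ-pres g (to (edge↔ f) e)) (≐-map (to (vert↔ g)) (endsᴿ-pres f e))
  ; root₀-pres = trans (cong (to (vert↔ g)) (root₀-pres f)) (root₀-pres g)
  ; root₁-pres = trans (cong (to (vert↔ g)) (root₁-pres f)) (root₁-pres g) }

rerooted : (G : Rooted) → Vert G → Vert G → Rooted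
rerooted G u w = record G { root₀ = u ; root₁ = w }

reroot : {G H : Rooted} (f : G ≃ H) (u w : Vert G) →
  rerooted G u w ≃ rerooted H (to (vert↔ f) u) (to (vert↔ f) w)
reroot f u w = record { vert↔ = vert↔ f ; edge↔ = edge↔ f ; endsᴿ-pres = endsᴿ-pres f
                      ; root₀-pres = refl ; root₁-pres = refl }

asRooted : RGraph → Rooted
asRooted R = record { Vert = Fin (n (graph R)) ; Edge = Fin (m (graph R)) ; endsᴿ = ends (graph R)
                    ; root₀ = src R ; root₁ = tgt R }

≅⇒≃ : {R R′ : RGraph} → R ≅ R′ → asRooted R ≃ asRooted R′
≅⇒≃ f = record { vert↔ = _≅_.vmap f ; edge↔ = _≅_.emap f ; endsᴿ-pres = _≅_.ends-pres f
               ; root₀-pres = _≅_.src-pres f ; root₁-pres = _≅_.tgt-pres f }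

≃⇒≅ : {R R′ : RGraph} → asRooted R ≃ asRooted R′ → R ≅ R′
≃⇒≅ f = record { vmap = vert↔ f ; emap = edge↔ f ; ends-pres = endsᴿ-pres f
               ; src-pres = root₀-pres f ; tgt-pres = root₁-pres f }

data Vertex (I : Set) : Set where
  source sink : Vertex I
  inner       : I → Vertex I

record TwoTerminal : Set₁ where
  field
    Inner Edgeᵀ : Set
    endsᵀ       : Edgeᵀ → Vertex Inner × Vertex Inner
open TwoTerminal

toRooted : TwoTerminal → Rooted
toRooted A = record { Vert = Vertex (Inner A) ; Edge = Edgeᵀ A ; endsᴿ = endsᵀ A
                    ; root₀ = source ; root₁ = sink }

-- In a series composition the identified vertex is `inner (inj₁ tt)`.
seriesˡ : {I J : Set} → Vertex I → Vertex (⊤ ⊎ (I ⊎ J))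
seriesˡ source    = source
seriesˡ sink      = inner (inj₁ tt)
seriesˡ (inner i) = inner (inj₂ (inj₁ i))

seriesʳ : {I J : Set} → Vertex J → Vertex (⊤ ⊎ (I ⊎ J))
seriesʳ source    = inner (inj₁ tt)
seriesʳ sink      = sink
seriesʳ (inner j) = inner (inj₂ (inj₂ j))

parallelˡ : {I J : Set} → Vertex I → Vertex (I ⊎ J)
parallelˡ source    = source
parallelˡ sink      = sink
parallelˡ (inner i) = inner (inj₁ i)

parallelʳ : {I J : Set} → Vertex J → Vertex (I ⊎ J)
parallelʳ source    = source
parallelʳ sink      = sink
parallelʳ (inner j) = inner (inj₂ j)

infixr 6 _⊙_
infixr 5 _∥_

_⊙_ : TwoTerminal → TwoTerminal → TwoTerminal
A ⊙ B = record { Inner = ⊤ ⊎ (Inner A ⊎ Inner B) ; Edgeᵀ = Edgeᵀ A ⊎ Edgeᵀ B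
               ; endsᵀ = [ map2 seriesˡ ∘ endsᵀ A , map2 seriesʳ ∘ endsᵀ B ] }

_∥_ : TwoTerminal → TwoTerminal → TwoTerminal
A ∥ B = record { Inner = Inner A ⊎ Inner B ; Edgeᵀ = Edgeᵀ A ⊎ Edgeᵀ B
               ; endsᵀ = [ map2 parallelˡ ∘ endsᵀ A , map2 parallelʳ ∘ endsᵀ B ] }

K₂ᵀ : TwoTerminal
K₂ᵀ = record { Inner = ⊥ ; Edgeᵀ = ⊤ ; endsᵀ = λ _ → source , sink }

⟦_⟧ : SPTree → TwoTerminal
⟦ K2 ⟧      = K₂ᵀ
⟦ ser s t ⟧ = ⟦ s ⟧ ⊙ ⟦ t ⟧
⟦ par s t ⟧ = ⟦ s ⟧ ∥ ⟦ t ⟧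

-- `mapVertex true` exchanges the two terminals.
mapVertex : {I J : Set} → Bool → (I → J) → Vertex I → Vertex J
mapVertex false f source    = source
mapVertex false f sink      = sink
mapVertex true  f source    = sink
mapVertex true  f sink      = source
mapVertex _     f (inner i) = inner (f i)

mapVertex-id : {I : Set} (v : Vertex I) → mapVertex false id v ≡ v
mapVertex-id source    = refl
mapVertex-id sink      = refl
mapVertex-id (inner i) = refl

mapVertex-inverse : {I J : Set} {f : J → I} {g : I → J} → (∀ i → f (g i) ≡ i) →
  ∀ v → mapVertex false f (mapVertex false g v) ≡ v
mapVertex-inverse fg source    = refl
mapVertex-inverse fg sink      = refl
mapVertex-inverse fg (inner i) = cong inner (fg i)

mapVertex-∘ : {I J K : Set} (f : J → K) (g : I → J) →
  ∀ v → mapVertex false f (mapVertex false g v) ≡ mapVertex false (f ∘ g) v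
mapVertex-∘ f g source    = refl
mapVertex-∘ f g sink      = refl
mapVertex-∘ f g (inner i) = refl

Vertex↔ : {I J : Set} → I ↔ J → Vertex I ↔ Vertex J
Vertex↔ f = mk↔ₛ′ (mapVertex false (to f)) (mapVertex false (from f))
                  (mapVertex-inverse (strictlyInverseˡ f)) (mapVertex-inverse (strictlyInverseʳ f))

record TTIso (flip : Bool) (A B : TwoTerminal) : Set where
  field
    inner↔     : Inner A ↔ Inner B
    edgeᵀ↔     : Edgeᵀ A ↔ Edgeᵀ B
    endsᵀ-pres : ∀ e → endsᵀ B (to edgeᵀ↔ e) ≐ map2 (mapVertex flip (to inner↔)) (endsᵀ A e)
open TTIso

infix 4 _≈_ _≈ʳ_
_≈_ _≈ʳ_ : TwoTerminal → TwoTerminal → Set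
_≈_  = TTIso false
_≈ʳ_ = TTIso true

≈⇒≃ : {A B : TwoTerminal} → A ≈ B → toRooted A ≃ toRooted B
≈⇒≃ f = record { vert↔ = Vertex↔ (inner↔ f) ; edge↔ = edgeᵀ↔ f ; endsᴿ-pres = endsᵀ-pres f
               ; root₀-pres = refl ; root₁-pres = refl }

≈-refl : {A : TwoTerminal} → A ≈ A
≈-refl {A} = record { inner↔ = ↔-refl ; edgeᵀ↔ = ↔-refl
  ; endsᵀ-pres = λ e → inj₁ (sym (map2-cong mapVertex-id (endsᵀ A e))) }

≈-sym : {A B : TwoTerminal} → A ≈ B → B ≈ A
≈-sym f = record { inner↔ = ↔-sym (inner↔ f) ; edgeᵀ↔ = ↔-sym (edgeᵀ↔ f)
                 ; endsᵀ-pres = endsᴿ-pres (≃-sym (≈⇒≃ f)) }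

infixr 5 _⨾_
_⨾_ : {A B C : TwoTerminal} → A ≈ B → B ≈ C → A ≈ C
_⨾_ {A} f g = record
  { inner↔ = ↔-trans (inner↔ f) (inner↔ g) ; edgeᵀ↔ = ↔-trans (edgeᵀ↔ f) (edgeᵀ↔ g)
  ; endsᵀ-pres = λ e → ≐-trans (endsᴿ-pres (≃-trans (≈⇒≃ f) (≈⇒≃ g)) e)
                         (inj₁ (map2-cong (mapVertex-∘ (to (inner↔ g)) (to (inner↔ f))) (endsᵀ A e))) }

⊎-assoc₀ : {A B C : Set} → ((A ⊎ B) ⊎ C) ↔ (A ⊎ (B ⊎ C))
⊎-assoc₀ = ⊎-assoc 0ℓ _ _ _

≐-square : (g : U → W) (G : V → W) (h : U → V) → (∀ u → g u ≡ G (h u)) →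
  ∀ p → map2 g p ≐ map2 G (map2 h p)
≐-square g G h square p = inj₁ (map2-cong square p)

≐-via : {flip : Bool} {A B : TwoTerminal} (f : TTIso flip A B) (g : Vertex (Inner B) → W) (G : V → W)
  (h : Vertex (Inner A) → V) → (∀ v → g (mapVertex flip (to (inner↔ f)) v) ≡ G (h v)) →
  ∀ e → map2 g (endsᵀ B (to (edgeᵀ↔ f) e)) ≐ map2 G (map2 h (endsᵀ A e))
≐-via {A = A} f g G h square e = ≐-trans (≐-map g (endsᵀ-pres f e)) (≐-square _ G h square (endsᵀ A e))

⊙-cong : {A A′ B B′ : TwoTerminal} → A ≈ A′ → B ≈ B′ → A ⊙ B ≈ A′ ⊙ B′
⊙-cong f g = record
  { inner↔ = I ; edgeᵀ↔ = ⊎-cong (edgeᵀ↔ f) (edgeᵀ↔ g)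
  ; endsᵀ-pres = λ
    { (inj₁ e) → ≐-via f seriesˡ (mapVertex false (to I)) seriesˡ
        (λ { source → refl ; sink → refl ; (inner _) → refl }) e
    ; (inj₂ e) → ≐-via g seriesʳ (mapVertex false (to I)) seriesʳ
        (λ { source → refl ; sink → refl ; (inner _) → refl }) e } }
  where I = ⊎-cong ↔-refl (⊎-cong (inner↔ f) (inner↔ g))

∥-cong : {A A′ B B′ : TwoTerminal} → A ≈ A′ → B ≈ B′ → A ∥ B ≈ A′ ∥ B′
∥-cong f g = record
  { inner↔ = I ; edgeᵀ↔ = ⊎-cong (edgeᵀ↔ f) (edgeᵀ↔ g)
  ; endsᵀ-pres = λ
    { (inj₁ e) → ≐-via f parallelˡ (mapVertex false (to I)) parallelˡ
        (λ { source → refl ; sink → refl ; (inner _) → refl }) e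
    ; (inj₂ e) → ≐-via g parallelʳ (mapVertex false (to I)) parallelʳ
        (λ { source → refl ; sink → refl ; (inner _) → refl }) e } }
  where I = ⊎-cong (inner↔ f) (inner↔ g)

∥-comm : {A B : TwoTerminal} → A ∥ B ≈ B ∥ A
∥-comm {A} {B} = record
  { inner↔ = swap-↔ ; edgeᵀ↔ = swap-↔
  ; endsᵀ-pres = λ
    { (inj₁ e) → ≐-square parallelʳ (mapVertex false (to swap-↔)) parallelˡ
        (λ { source → refl ; sink → refl ; (inner _) → refl }) (endsᵀ A e)
    ; (inj₂ e) → ≐-square parallelˡ (mapVertex false (to swap-↔)) parallelʳ
        (λ { source → refl ; sink → refl ; (inner _) → refl }) (endsᵀ B e) } }

∥-assoc : {A B C : TwoTerminal} → (A ∥ B) ∥ C ≈ A ∥ (B ∥ C)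
∥-assoc {A} {B} {C} = record
  { inner↔ = ⊎-assoc₀ ; edgeᵀ↔ = ⊎-assoc₀
  ; endsᵀ-pres = λ
    { (inj₁ (inj₁ e)) → ≐-square parallelˡ G (parallelˡ ∘ parallelˡ)
        (λ { source → refl ; sink → refl ; (inner _) → refl }) (endsᵀ A e)
    ; (inj₁ (inj₂ e)) → ≐-square (parallelʳ ∘ parallelˡ) G (parallelˡ ∘ parallelʳ)
        (λ { source → refl ; sink → refl ; (inner _) → refl }) (endsᵀ B e)
    ; (inj₂ e) → ≐-square (parallelʳ ∘ parallelʳ) G parallelʳ
        (λ { source → refl ; sink → refl ; (inner _) → refl }) (endsᵀ C e) } }
  where G = mapVertex false (to ⊎-assoc₀)

⊙-assoc : {A B C : TwoTerminal} → (A ⊙ B) ⊙ C ≈ A ⊙ (B ⊙ C)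
⊙-assoc {A} {B} {C} = record
  { inner↔ = I ; edgeᵀ↔ = ⊎-assoc₀
  ; endsᵀ-pres = λ
    { (inj₁ (inj₁ e)) → ≐-square seriesˡ G (seriesˡ ∘ seriesˡ)
        (λ { source → refl ; sink → refl ; (inner _) → refl }) (endsᵀ A e)
    ; (inj₁ (inj₂ e)) → ≐-square (seriesʳ ∘ seriesˡ) G (seriesˡ ∘ seriesʳ)
        (λ { source → refl ; sink → refl ; (inner _) → refl }) (endsᵀ B e)
    ; (inj₂ e) → ≐-square (seriesʳ ∘ seriesʳ) G seriesʳ
        (λ { source → refl ; sink → refl ; (inner _) → refl }) (endsᵀ C e) } }
  where
  I : (⊤ ⊎ ((⊤ ⊎ (Inner A ⊎ Inner B)) ⊎ Inner C)) ↔ (⊤ ⊎ (Inner A ⊎ (⊤ ⊎ (Inner B ⊎ Inner C))))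
  I = mk↔ₛ′
    (λ { (inj₁ tt) → inj₂ (inj₂ (inj₁ tt)) ; (inj₂ (inj₁ (inj₁ tt))) → inj₁ tt
       ; (inj₂ (inj₁ (inj₂ (inj₁ a)))) → inj₂ (inj₁ a) ; (inj₂ (inj₁ (inj₂ (inj₂ b)))) → inj₂ (inj₂ (inj₂ (inj₁ b)))
       ; (inj₂ (inj₂ c)) → inj₂ (inj₂ (inj₂ (inj₂ c))) })
    (λ { (inj₂ (inj₂ (inj₁ tt))) → inj₁ tt ; (inj₁ tt) → inj₂ (inj₁ (inj₁ tt))
       ; (inj₂ (inj₁ a)) → inj₂ (inj₁ (inj₂ (inj₁ a))) ; (inj₂ (inj₂ (inj₂ (inj₁ b)))) → inj₂ (inj₁ (inj₂ (inj₂ b)))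
       ; (inj₂ (inj₂ (inj₂ (inj₂ c)))) → inj₂ (inj₂ c) })
    (λ { (inj₂ (inj₂ (inj₁ tt))) → refl ; (inj₁ tt) → refl ; (inj₂ (inj₁ a)) → refl
       ; (inj₂ (inj₂ (inj₂ (inj₁ b)))) → refl ; (inj₂ (inj₂ (inj₂ (inj₂ c)))) → refl })
    (λ { (inj₁ tt) → refl ; (inj₂ (inj₁ (inj₁ tt))) → refl ; (inj₂ (inj₁ (inj₂ (inj₁ a)))) → refl
       ; (inj₂ (inj₁ (inj₂ (inj₂ b)))) → refl ; (inj₂ (inj₂ c)) → refl })
  G = mapVertex false (to I)

⊙-reverse : {A A′ B B′ : TwoTerminal} → A′ ≈ʳ A → B′ ≈ʳ B → B′ ⊙ A′ ≈ʳ A ⊙ B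
⊙-reverse f g = record
  { inner↔ = I ; edgeᵀ↔ = ↔-trans (⊎-cong (edgeᵀ↔ g) (edgeᵀ↔ f)) swap-↔
  ; endsᵀ-pres = λ
    { (inj₁ e) → ≐-via g seriesʳ (mapVertex true (to I)) seriesˡ
        (λ { source → refl ; sink → refl ; (inner _) → refl }) e
    ; (inj₂ e) → ≐-via f seriesˡ (mapVertex true (to I)) seriesʳ
        (λ { source → refl ; sink → refl ; (inner _) → refl }) e } }
  where I = ⊎-cong ↔-refl (↔-trans (⊎-cong (inner↔ g) (inner↔ f)) swap-↔)

∥-reverse : {A A′ B B′ : TwoTerminal} → A′ ≈ʳ A → B′ ≈ʳ B → A′ ∥ B′ ≈ʳ A ∥ B
∥-reverse f g = record
  { inner↔ = I ; edgeᵀ↔ = ⊎-cong (edgeᵀ↔ f) (edgeᵀ↔ g)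
  ; endsᵀ-pres = λ
    { (inj₁ e) → ≐-via f parallelˡ (mapVertex true (to I)) parallelˡ
        (λ { source → refl ; sink → refl ; (inner _) → refl }) e
    ; (inj₂ e) → ≐-via g parallelʳ (mapVertex true (to I)) parallelʳ
        (λ { source → refl ; sink → refl ; (inner _) → refl }) e } }
  where I = ⊎-cong (inner↔ f) (inner↔ g)

reverse : SPTree → SPTree
reverse K2        = K2
reverse (ser s t) = ser (reverse t) (reverse s)
reverse (par s t) = par (reverse s) (reverse t)

reverse-≈ʳ : ∀ t → ⟦ reverse t ⟧ ≈ʳ ⟦ t ⟧
reverse-≈ʳ K2        = record { inner↔ = ↔-refl ; edgeᵀ↔ = ↔-refl ; endsᵀ-pres = λ _ → inj₂ refl }
reverse-≈ʳ (ser s t) = ⊙-reverse (reverse-≈ʳ s) (reverse-≈ʳ t)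
reverse-≈ʳ (par s t) = ∥-reverse (reverse-≈ʳ s) (reverse-≈ʳ t)

-- Old sink becomes the junction of A and the reversed C.
pivot : {A B C C′ : TwoTerminal} → C′ ≈ʳ C →
  toRooted (B ∥ (A ⊙ C′)) ≃ rerooted (toRooted (A ∥ (B ⊙ C))) source (parallelʳ (seriesˡ sink))
pivot {A} {B} {C} {C′} h = record
  { vert↔ = P ; edge↔ = Q ; root₀-pres = refl ; root₁-pres = refl
  ; endsᴿ-pres = λ
    { (inj₁ b) → ≐-square (parallelʳ ∘ seriesˡ) (to P) parallelˡ
        (λ { source → refl ; sink → refl ; (inner _) → refl }) (endsᵀ B b)
    ; (inj₂ (inj₁ a)) → ≐-square parallelˡ (to P) (parallelʳ ∘ seriesˡ)
        (λ { source → refl ; sink → refl ; (inner _) → refl }) (endsᵀ A a)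
    ; (inj₂ (inj₂ c)) → ≐-via h (parallelʳ ∘ seriesʳ) (to P) (parallelʳ ∘ seriesʳ)
        (λ { source → refl ; sink → refl ; (inner _) → refl }) c } }
  where
  P : Vertex (Inner B ⊎ (⊤ ⊎ (Inner A ⊎ Inner C′))) ↔ Vertex (Inner A ⊎ (⊤ ⊎ (Inner B ⊎ Inner C)))
  P = mk↔ₛ′
    (λ { source → source ; sink → inner (inj₂ (inj₁ tt)) ; (inner (inj₁ b)) → inner (inj₂ (inj₂ (inj₁ b)))
       ; (inner (inj₂ (inj₁ tt))) → sink ; (inner (inj₂ (inj₂ (inj₁ a)))) → inner (inj₁ a)
       ; (inner (inj₂ (inj₂ (inj₂ c)))) → inner (inj₂ (inj₂ (inj₂ (to (inner↔ h) c)))) })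
    (λ { source → source ; (inner (inj₂ (inj₁ tt))) → sink ; (inner (inj₂ (inj₂ (inj₁ b)))) → inner (inj₁ b)
       ; sink → inner (inj₂ (inj₁ tt)) ; (inner (inj₁ a)) → inner (inj₂ (inj₂ (inj₁ a)))
       ; (inner (inj₂ (inj₂ (inj₂ c)))) → inner (inj₂ (inj₂ (inj₂ (from (inner↔ h) c)))) })
    (λ { source → refl ; (inner (inj₂ (inj₁ tt))) → refl ; (inner (inj₂ (inj₂ (inj₁ b)))) → refl
       ; sink → refl ; (inner (inj₁ a)) → refl
       ; (inner (inj₂ (inj₂ (inj₂ c)))) → cong (inner ∘ inj₂ ∘ inj₂ ∘ inj₂) (strictlyInverseˡ (inner↔ h) c) })
    (λ { source → refl ; sink → refl ; (inner (inj₁ b)) → refl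
       ; (inner (inj₂ (inj₁ tt))) → refl ; (inner (inj₂ (inj₂ (inj₁ a)))) → refl
       ; (inner (inj₂ (inj₂ (inj₂ c)))) → cong (inner ∘ inj₂ ∘ inj₂ ∘ inj₂) (strictlyInverseʳ (inner↔ h) c) })
  Q : (Edgeᵀ B ⊎ (Edgeᵀ A ⊎ Edgeᵀ C′)) ↔ (Edgeᵀ A ⊎ (Edgeᵀ B ⊎ Edgeᵀ C))
  Q = mk↔ₛ′
    (λ { (inj₁ b) → inj₂ (inj₁ b) ; (inj₂ (inj₁ a)) → inj₁ a ; (inj₂ (inj₂ c)) → inj₂ (inj₂ (to (edgeᵀ↔ h) c)) })
    (λ { (inj₂ (inj₁ b)) → inj₁ b ; (inj₁ a) → inj₂ (inj₁ a) ; (inj₂ (inj₂ c)) → inj₂ (inj₂ (from (edgeᵀ↔ h) c)) })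
    (λ { (inj₂ (inj₁ b)) → refl ; (inj₁ a) → refl ; (inj₂ (inj₂ c)) → cong (inj₂ ∘ inj₂) (strictlyInverseˡ (edgeᵀ↔ h) c) })
    (λ { (inj₁ b) → refl ; (inj₂ (inj₁ a)) → refl ; (inj₂ (inj₂ c)) → cong (inj₂ ∘ inj₂) (strictlyInverseʳ (edgeᵀ↔ h) c) })

innerFin : ∀ t → Fin (internal t) ↔ Inner ⟦ t ⟧
innerFin K2        = 0↔⊥
innerFin (ser s t) = ↔-trans +↔⊎ (⊎-cong 1↔⊤ (↔-trans +↔⊎ (⊎-cong (innerFin s) (innerFin t))))
innerFin (par s t) = ↔-trans +↔⊎ (⊎-cong (innerFin s) (innerFin t))

edgeFin : ∀ t → Fin (nedges t) ↔ Edgeᵀ ⟦ t ⟧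
edgeFin K2        = 1↔⊤
edgeFin (ser s t) = ↔-trans +↔⊎ (⊎-cong (edgeFin s) (edgeFin t))
edgeFin (par s t) = ↔-trans +↔⊎ (⊎-cong (edgeFin s) (edgeFin t))

vertexFin : {k : ℕ} {I : Set} → Fin k ↔ I → Fin (suc (suc k)) ↔ Vertex I
vertexFin f = mk↔ₛ′
  (λ { zero → source ; (suc zero) → sink ; (suc (suc i)) → inner (to f i) })
  (λ { source → zero ; sink → suc zero ; (inner j) → suc (suc (from f j)) })
  (λ { source → refl ; sink → refl ; (inner j) → cong inner (strictlyInverseˡ f j) })
  (λ { zero → refl ; (suc zero) → refl ; (suc (suc i)) → cong (λ j → suc (suc j)) (strictlyInverseʳ f i) })

vertex⁻ : ∀ t → Vertex (Inner ⟦ t ⟧) → Fin (suc (suc (internal t)))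
vertex⁻ t = from (vertexFin (innerFin t))

map2-embed : (φ : U → V) (ψ : W → U) (Ψ : X → V) (ι : W → X) → (∀ w → φ (ψ w) ≡ Ψ (ι w)) →
  {x : V × V} {p : U × U} {q : W × W} → x ≡ map2 φ p → p ≡ map2 ψ q → x ≡ map2 Ψ (map2 ι q)
map2-embed φ ψ Ψ ι square {q = q} refl refl = map2-cong square q

module _ (s t : SPTree) where
  spEnds-serˡ : ∀ i → spEnds (ser s t) (i ↑ˡ nedges t) ≡ map2 (serL (internal s) (internal t)) (spEnds s i)
  spEnds-serˡ i rewrite splitAt-↑ˡ (nedges s) i (nedges t) = refl
  spEnds-serʳ : ∀ j → spEnds (ser s t) (nedges s ↑ʳ j) ≡ map2 (serR (internal s) (internal t)) (spEnds t j)
  spEnds-serʳ j rewrite splitAt-↑ʳ (nedges s) (nedges t) j = refl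
  spEnds-parˡ : ∀ i → spEnds (par s t) (i ↑ˡ nedges t) ≡ map2 (parL (internal s) (internal t)) (spEnds s i)
  spEnds-parˡ i rewrite splitAt-↑ˡ (nedges s) i (nedges t) = refl
  spEnds-parʳ : ∀ j → spEnds (par s t) (nedges s ↑ʳ j) ≡ map2 (parR (internal s) (internal t)) (spEnds t j)
  spEnds-parʳ j rewrite splitAt-↑ʳ (nedges s) (nedges t) j = refl

  serL-vertex⁻ : ∀ v → serL (internal s) (internal t) (vertex⁻ s v) ≡ vertex⁻ (ser s t) (seriesˡ v)
  serL-vertex⁻ source    = refl
  serL-vertex⁻ sink      = refl
  serL-vertex⁻ (inner _) = refl
  serR-vertex⁻ : ∀ v → serR (internal s) (internal t) (vertex⁻ t v) ≡ vertex⁻ (ser s t) (seriesʳ v)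
  serR-vertex⁻ source    = refl
  serR-vertex⁻ sink      = refl
  serR-vertex⁻ (inner _) = refl
  parL-vertex⁻ : ∀ v → parL (internal s) (internal t) (vertex⁻ s v) ≡ vertex⁻ (par s t) (parallelˡ v)
  parL-vertex⁻ source    = refl
  parL-vertex⁻ sink      = refl
  parL-vertex⁻ (inner _) = refl
  parR-vertex⁻ : ∀ v → parR (internal s) (internal t) (vertex⁻ t v) ≡ vertex⁻ (par s t) (parallelʳ v)
  parR-vertex⁻ source    = refl
  parR-vertex⁻ sink      = refl
  parR-vertex⁻ (inner _) = refl

spEnds-⟦⟧ : ∀ t e → spEnds t (from (edgeFin t) e) ≡ map2 (vertex⁻ t) (endsᵀ ⟦ t ⟧ e)
spEnds-⟦⟧ K2 tt = refl
spEnds-⟦⟧ (ser s t) (inj₁ e) =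
  map2-embed (serL _ _) (vertex⁻ s) (vertex⁻ (ser s t)) seriesˡ (serL-vertex⁻ s t) (spEnds-serˡ s t _) (spEnds-⟦⟧ s e)
spEnds-⟦⟧ (ser s t) (inj₂ e) =
  map2-embed (serR _ _) (vertex⁻ t) (vertex⁻ (ser s t)) seriesʳ (serR-vertex⁻ s t) (spEnds-serʳ s t _) (spEnds-⟦⟧ t e)
spEnds-⟦⟧ (par s t) (inj₁ e) =
  map2-embed (parL _ _) (vertex⁻ s) (vertex⁻ (par s t)) parallelˡ (parL-vertex⁻ s t) (spEnds-parˡ s t _) (spEnds-⟦⟧ s e)
spEnds-⟦⟧ (par s t) (inj₂ e) =
  map2-embed (parR _ _) (vertex⁻ t) (vertex⁻ (par s t)) parallelʳ (parR-vertex⁻ s t) (spEnds-parʳ s t _) (spEnds-⟦⟧ t e)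

⟦⟧≃spGraph : ∀ t → toRooted ⟦ t ⟧ ≃ asRooted (spGraph t)
⟦⟧≃spGraph t = record { vert↔ = ↔-sym (vertexFin (innerFin t)) ; edge↔ = ↔-sym (edgeFin t)
                      ; endsᴿ-pres = λ e → inj₁ (spEnds-⟦⟧ t e) ; root₀-pres = refl ; root₁-pres = refl }

-- The dmt-step

dmtEnds : {E : Set} → DecidableEquality E → (E → V × V) → E → (V → W) → W → W → E ⊎ Fin 3 → W × W
dmtEnds _≟ᴱ_ ends ℓ old a b (inj₁ f) with f ≟ᴱ ℓ
... | yes _ = old (proj₁ (ends ℓ)) , a
... | no _  = map2 old (ends f)
dmtEnds _≟ᴱ_ ends ℓ old a b (inj₂ zero)          = a , b
dmtEnds _≟ᴱ_ ends ℓ old a b (inj₂ (suc zero))    = a , b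
dmtEnds _≟ᴱ_ ends ℓ old a b (inj₂ (suc (suc _))) = b , old (proj₂ (ends ℓ))

dmtEnds-map : {E : Set} (d : DecidableEquality E) (ends : E → V × V) (ℓ : E) (old : V → W) (a b : W)
  (h : W → X) → ∀ x → map2 h (dmtEnds d ends ℓ old a b x) ≡ dmtEnds d ends ℓ (h ∘ old) (h a) (h b) x
dmtEnds-map d ends ℓ old a b h (inj₁ f) with d f ℓ
... | yes _ = refl
... | no _  = refl
dmtEnds-map d ends ℓ old a b h (inj₂ zero)          = refl
dmtEnds-map d ends ℓ old a b h (inj₂ (suc zero))    = refl
dmtEnds-map d ends ℓ old a b h (inj₂ (suc (suc _))) = refl

τᴿ : (G : Rooted) → DecidableEquality (Edge G) → Edge G → Rooted
τᴿ G d ℓ = record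
  { Vert = Vert G ⊎ Fin 2 ; Edge = Edge G ⊎ Fin 3
  ; endsᴿ = dmtEnds d (endsᴿ G) ℓ inj₁ (inj₂ zero) (inj₂ (suc zero))
  ; root₀ = inj₁ (root₀ G) ; root₁ = inj₁ (root₁ G) }

weaken : {I J : Set} → Vertex I → Vertex (I ⊎ J)
weaken = mapVertex false inj₁

τᵀ : (A : TwoTerminal) → DecidableEquality (Edgeᵀ A) → Edgeᵀ A → TwoTerminal
τᵀ A d ℓ = record
  { Inner = Inner A ⊎ Fin 2 ; Edgeᵀ = Edgeᵀ A ⊎ Fin 3
  ; endsᵀ = dmtEnds d (endsᵀ A) ℓ weaken (inner (inj₂ zero)) (inner (inj₂ (suc zero))) }

τᴿ-toRooted : (A : TwoTerminal) (d : DecidableEquality (Edgeᵀ A)) (ℓ : Edgeᵀ A) →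
  τᴿ (toRooted A) d ℓ ≃ toRooted (τᵀ A d ℓ)
τᴿ-toRooted A d ℓ = record
  { vert↔ = P ; edge↔ = ↔-refl ; root₀-pres = refl ; root₁-pres = refl
  ; endsᴿ-pres = λ x → inj₁ (sym (dmtEnds-map d (endsᵀ A) ℓ inj₁ (inj₂ zero) (inj₂ (suc zero)) (to P) x)) }
  where
  P : (Vertex (Inner A) ⊎ Fin 2) ↔ Vertex (Inner A ⊎ Fin 2)
  P = mk↔ₛ′ [ weaken , inner ∘ inj₂ ]
    (λ { source → inj₁ source ; sink → inj₁ sink ; (inner (inj₁ i)) → inj₁ (inner i) ; (inner (inj₂ k)) → inj₂ k })
    (λ { source → refl ; sink → refl ; (inner (inj₁ i)) → refl ; (inner (inj₂ k)) → refl })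
    (λ { (inj₁ source) → refl ; (inj₁ sink) → refl ; (inj₁ (inner i)) → refl ; (inj₂ k) → refl })

τᴿ-asRooted : (R : RGraph) (e : Fin (m (graph R))) → τᴿ (asRooted R) _≟_ e ≃ asRooted (tau R e)
τᴿ-asRooted R e = record
  { vert↔ = ↔-sym +↔⊎ ; edge↔ = ↔-sym +↔⊎ ; root₀-pres = refl ; root₁-pres = refl
  ; endsᴿ-pres = λ x →
      inj₁ (trans (tauEnds x) (sym (dmtEnds-map _≟_ (ends G) e inj₁ (inj₂ zero) (inj₂ (suc zero)) (join (n G) 2) x))) }
  where
  G = graph R
  tauEnds : ∀ x → ends (tauGraph G e) (join (m G) 3 x)
                  ≡ dmtEnds _≟_ (ends G) e (_↑ˡ 2) (n G ↑ʳ zero) (n G ↑ʳ suc zero) x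
  tauEnds (inj₁ f) rewrite splitAt-↑ˡ (m G) f 3 with f ≟ e
  ... | yes _ = refl
  ... | no _  = refl
  tauEnds (inj₂ k) rewrite splitAt-↑ʳ (m G) 3 k with k
  ... | zero           = refl
  ... | suc zero       = refl
  ... | suc (suc zero) = refl

module _ {G H : Rooted} (dG : DecidableEquality (Edge G)) (dH : DecidableEquality (Edge H))
         (f : G ≃ H) (ℓ : Edge G) where

  private
    ℓ′ = to (edge↔ f) ℓ

    τG τH : Rooted
    τG = τᴿ G dG ℓ
    τH = τᴿ H dH ℓ′

    aligned : endsᴿ H ℓ′ ≡ map2 (to (vert↔ f)) (endsᴿ G ℓ) → τG ≃ τH
    aligned eq = record
      { vert↔ = P ; edge↔ = Q ; endsᴿ-pres = pres
      ; root₀-pres = cong inj₁ (root₀-pres f) ; root₁-pres = cong inj₁ (root₁-pres f) }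
      where
      P = ⊎-cong (vert↔ f) ↔-refl
      Q = ⊎-cong (edge↔ f) ↔-refl
      pres : ∀ x → endsᴿ τH (to Q x) ≐ map2 (to P) (endsᴿ τG x)
      pres (inj₁ g) with dG g ℓ | dH (to (edge↔ f) g) ℓ′
      ... | yes refl | yes _     = inj₁ (cong (λ p → inj₁ (proj₁ p) , inj₂ zero) eq)
      ... | yes refl | no ℓ′≢ℓ′ = ⊥-elim (ℓ′≢ℓ′ refl)
      ... | no g≢ℓ   | yes eq′   = ⊥-elim (g≢ℓ (↔-injective (edge↔ f) eq′))
      ... | no _     | no _      = ≐-map inj₁ (endsᴿ-pres f g)
      pres (inj₂ zero)             = inj₁ refl
      pres (inj₂ (suc zero))       = inj₁ refl
      pres (inj₂ (suc (suc zero))) = inj₁ (cong (λ p → inj₂ (suc zero) , inj₁ (proj₂ p)) eq)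

    -- If f reverses ℓ, the two new vertices are exchanged, and so are ℓ and the third new edge.
    exchange : Edge G ⊎ Fin 3 → Edge G ⊎ Fin 3
    exchange (inj₁ g) with dG g ℓ
    ... | yes _ = inj₂ (suc (suc zero))
    ... | no _  = inj₁ g
    exchange (inj₂ zero)             = inj₂ zero
    exchange (inj₂ (suc zero))       = inj₂ (suc zero)
    exchange (inj₂ (suc (suc zero))) = inj₁ ℓ

    exchange-ℓ : exchange (inj₁ ℓ) ≡ inj₂ (suc (suc zero))
    exchange-ℓ with dG ℓ ℓ
    ... | yes _   = refl
    ... | no ℓ≢ℓ = ⊥-elim (ℓ≢ℓ refl)

    exchange-involutive : ∀ x → exchange (exchange x) ≡ x
    exchange-involutive (inj₁ g) with dG g ℓ
    ... | yes refl = refl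
    ... | no g≢ℓ with dG g ℓ
    ...   | yes g≡ℓ = ⊥-elim (g≢ℓ g≡ℓ)
    ...   | no _    = refl
    exchange-involutive (inj₂ zero)             = refl
    exchange-involutive (inj₂ (suc zero))       = refl
    exchange-involutive (inj₂ (suc (suc zero))) = exchange-ℓ

    reversed : endsᴿ H ℓ′ ≡ swap (map2 (to (vert↔ f)) (endsᴿ G ℓ)) → τG ≃ τH
    reversed eq = record
      { vert↔ = P ; edge↔ = Q ; endsᴿ-pres = pres
      ; root₀-pres = cong inj₁ (root₀-pres f) ; root₁-pres = cong inj₁ (root₁-pres f) }
      where
      P = ⊎-cong (vert↔ f) (mk↔ₛ′ (λ { zero → suc zero ; (suc zero) → zero }) (λ { zero → suc zero ; (suc zero) → zero })
                                  (λ { zero → refl ; (suc zero) → refl }) (λ { zero → refl ; (suc zero) → refl }))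
      Q = ↔-trans (mk↔ₛ′ exchange exchange exchange-involutive exchange-involutive) (⊎-cong (edge↔ f) ↔-refl)
      pres : ∀ x → endsᴿ τH (to Q x) ≐ map2 (to P) (endsᴿ τG x)
      pres (inj₁ g) with dG g ℓ
      ... | yes refl = inj₂ (cong (λ p → inj₂ (suc zero) , inj₁ (proj₂ p)) eq)
      ... | no g≢ℓ with dH (to (edge↔ f) g) ℓ′
      ...   | yes eq′ = ⊥-elim (g≢ℓ (↔-injective (edge↔ f) eq′))
      ...   | no _    = ≐-map inj₁ (endsᴿ-pres f g)
      pres (inj₂ zero)       = inj₂ refl
      pres (inj₂ (suc zero)) = inj₂ refl
      pres (inj₂ (suc (suc zero))) with dH ℓ′ ℓ′
      ... | yes _     = inj₂ (cong (λ p → inj₁ (proj₁ p) , inj₂ zero) eq)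
      ... | no ℓ′≢ℓ′ = ⊥-elim (ℓ′≢ℓ′ refl)

  τᴿ-cong : τᴿ G dG ℓ ≃ τᴿ H dH (to (edge↔ f) ℓ)
  τᴿ-cong with endsᴿ-pres f ℓ
  ... | inj₁ eq = aligned eq
  ... | inj₂ eq = reversed eq

⊎-swapʳ : {A B C : Set} → ((A ⊎ B) ⊎ C) ↔ ((A ⊎ C) ⊎ B)
⊎-swapʳ = ↔-trans ⊎-assoc₀ (↔-trans (⊎-cong ↔-refl swap-↔) (↔-sym ⊎-assoc₀))

module _ (A B : TwoTerminal) (dA : DecidableEquality (Edgeᵀ A)) (dB : DecidableEquality (Edgeᵀ B)) where

  τᵀ-⊙ˡ : ∀ ℓ → τᵀ (A ⊙ B) (≡-dec dA dB) (inj₁ ℓ) ≈ τᵀ A dA ℓ ⊙ B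
  τᵀ-⊙ˡ ℓ = record { inner↔ = I ; edgeᵀ↔ = ⊎-swapʳ ; endsᵀ-pres = pres }
    where
    I = ↔-trans ⊎-assoc₀ (⊎-cong ↔-refl ⊎-swapʳ)
    G = mapVertex false (to I)
    square : ∀ v → seriesˡ (weaken v) ≡ G (weaken (seriesˡ v))
    square = λ { source → refl ; sink → refl ; (inner _) → refl }
    pres : ∀ x → endsᵀ (τᵀ A dA ℓ ⊙ B) (to ⊎-swapʳ x) ≐ map2 G (endsᵀ (τᵀ (A ⊙ B) (≡-dec dA dB) (inj₁ ℓ)) x)
    pres (inj₁ (inj₁ f)) with dA f ℓ
    ... | yes _ = inj₁ (cong₂ _,_ (square (proj₁ (endsᵀ A ℓ))) refl)
    ... | no _  = ≐-square _ G (weaken ∘ seriesˡ) square (endsᵀ A f)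
    pres (inj₁ (inj₂ g)) = ≐-square seriesʳ G (weaken ∘ seriesʳ)
        (λ { source → refl ; sink → refl ; (inner _) → refl }) (endsᵀ B g)
    pres (inj₂ zero)             = inj₁ refl
    pres (inj₂ (suc zero))       = inj₁ refl
    pres (inj₂ (suc (suc zero))) = inj₁ (cong₂ _,_ refl (square (proj₂ (endsᵀ A ℓ))))

  τᵀ-⊙ʳ : ∀ ℓ → τᵀ (A ⊙ B) (≡-dec dA dB) (inj₂ ℓ) ≈ A ⊙ τᵀ B dB ℓ
  τᵀ-⊙ʳ ℓ = record { inner↔ = I ; edgeᵀ↔ = ⊎-assoc₀ ; endsᵀ-pres = pres }
    where
    I = ↔-trans ⊎-assoc₀ (⊎-cong ↔-refl ⊎-assoc₀)
    G = mapVertex false (to I)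
    square : ∀ v → seriesʳ (weaken v) ≡ G (weaken (seriesʳ v))
    square = λ { source → refl ; sink → refl ; (inner _) → refl }
    pres : ∀ x → endsᵀ (A ⊙ τᵀ B dB ℓ) (to ⊎-assoc₀ x) ≐ map2 G (endsᵀ (τᵀ (A ⊙ B) (≡-dec dA dB) (inj₂ ℓ)) x)
    pres (inj₁ (inj₂ f)) with dB f ℓ
    ... | yes _ = inj₁ (cong₂ _,_ (square (proj₁ (endsᵀ B ℓ))) refl)
    ... | no _  = ≐-square _ G (weaken ∘ seriesʳ) square (endsᵀ B f)
    pres (inj₁ (inj₁ g)) = ≐-square seriesˡ G (weaken ∘ seriesˡ)
        (λ { source → refl ; sink → refl ; (inner _) → refl }) (endsᵀ A g)
    pres (inj₂ zero)             = inj₁ refl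
    pres (inj₂ (suc zero))       = inj₁ refl
    pres (inj₂ (suc (suc zero))) = inj₁ (cong₂ _,_ refl (square (proj₂ (endsᵀ B ℓ))))

  τᵀ-∥ˡ : ∀ ℓ → τᵀ (A ∥ B) (≡-dec dA dB) (inj₁ ℓ) ≈ τᵀ A dA ℓ ∥ B
  τᵀ-∥ˡ ℓ = record { inner↔ = I ; edgeᵀ↔ = ⊎-swapʳ ; endsᵀ-pres = pres }
    where
    I = ⊎-swapʳ
    G = mapVertex false (to I)
    square : ∀ v → parallelˡ (weaken v) ≡ G (weaken (parallelˡ v))
    square = λ { source → refl ; sink → refl ; (inner _) → refl }
    pres : ∀ x → endsᵀ (τᵀ A dA ℓ ∥ B) (to ⊎-swapʳ x) ≐ map2 G (endsᵀ (τᵀ (A ∥ B) (≡-dec dA dB) (inj₁ ℓ)) x)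
    pres (inj₁ (inj₁ f)) with dA f ℓ
    ... | yes _ = inj₁ (cong₂ _,_ (square (proj₁ (endsᵀ A ℓ))) refl)
    ... | no _  = ≐-square _ G (weaken ∘ parallelˡ) square (endsᵀ A f)
    pres (inj₁ (inj₂ g)) = ≐-square parallelʳ G (weaken ∘ parallelʳ)
        (λ { source → refl ; sink → refl ; (inner _) → refl }) (endsᵀ B g)
    pres (inj₂ zero)             = inj₁ refl
    pres (inj₂ (suc zero))       = inj₁ refl
    pres (inj₂ (suc (suc zero))) = inj₁ (cong₂ _,_ refl (square (proj₂ (endsᵀ A ℓ))))

  τᵀ-∥ʳ : ∀ ℓ → τᵀ (A ∥ B) (≡-dec dA dB) (inj₂ ℓ) ≈ A ∥ τᵀ B dB ℓ
  τᵀ-∥ʳ ℓ = record { inner↔ = I ; edgeᵀ↔ = ⊎-assoc₀ ; endsᵀ-pres = pres }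
    where
    I = ⊎-assoc₀
    G = mapVertex false (to I)
    square : ∀ v → parallelʳ (weaken v) ≡ G (weaken (parallelʳ v))
    square = λ { source → refl ; sink → refl ; (inner _) → refl }
    pres : ∀ x → endsᵀ (A ∥ τᵀ B dB ℓ) (to ⊎-assoc₀ x) ≐ map2 G (endsᵀ (τᵀ (A ∥ B) (≡-dec dA dB) (inj₂ ℓ)) x)
    pres (inj₁ (inj₂ f)) with dB f ℓ
    ... | yes _ = inj₁ (cong₂ _,_ (square (proj₁ (endsᵀ B ℓ))) refl)
    ... | no _  = ≐-square _ G (weaken ∘ parallelʳ) square (endsᵀ B f)
    pres (inj₁ (inj₁ g)) = ≐-square parallelˡ G (weaken ∘ parallelˡ)
        (λ { source → refl ; sink → refl ; (inner _) → refl }) (endsᵀ A g)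
    pres (inj₂ zero)             = inj₁ refl
    pres (inj₂ (suc zero))       = inj₁ refl
    pres (inj₂ (suc (suc zero))) = inj₁ (cong₂ _,_ refl (square (proj₂ (endsᵀ B ℓ))))

decEdge : ∀ t → DecidableEquality (Edgeᵀ ⟦ t ⟧)
decEdge K2        = _≟⊤_
decEdge (ser s t) = ≡-dec (decEdge s) (decEdge t)
decEdge (par s t) = ≡-dec (decEdge s) (decEdge t)

dmt : SPTree
dmt = ser K2 (ser (par K2 K2) K2)

τᵀ-K₂ : τᵀ K₂ᵀ _≟⊤_ tt ≈ ⟦ dmt ⟧
τᵀ-K₂ = record { inner↔ = I ; edgeᵀ↔ = E ; endsᵀ-pres = λ
  { (inj₁ tt) → inj₁ refl ; (inj₂ zero) → inj₁ refl
  ; (inj₂ (suc zero)) → inj₁ refl ; (inj₂ (suc (suc zero))) → inj₁ refl } }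
  where
  I : (⊥ ⊎ Fin 2) ↔ Inner ⟦ dmt ⟧
  I = mk↔ₛ′ (λ { (inj₂ zero) → inj₁ tt ; (inj₂ (suc zero)) → inj₂ (inj₂ (inj₁ tt)) })
            (λ { (inj₁ tt) → inj₂ zero ; (inj₂ (inj₂ (inj₁ tt))) → inj₂ (suc zero)
               ; (inj₂ (inj₂ (inj₂ (inj₁ (inj₁ ()))))) ; (inj₂ (inj₂ (inj₂ (inj₁ (inj₂ ()))))) ; (inj₂ (inj₂ (inj₂ (inj₂ ())))) })
            (λ { (inj₁ tt) → refl ; (inj₂ (inj₂ (inj₁ tt))) → refl
               ; (inj₂ (inj₂ (inj₂ (inj₁ (inj₁ ()))))) ; (inj₂ (inj₂ (inj₂ (inj₁ (inj₂ ()))))) ; (inj₂ (inj₂ (inj₂ (inj₂ ())))) })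
            (λ { (inj₂ zero) → refl ; (inj₂ (suc zero)) → refl })
  E : (⊤ ⊎ Fin 3) ↔ Edgeᵀ ⟦ dmt ⟧
  E = mk↔ₛ′ (λ { (inj₁ tt) → inj₁ tt ; (inj₂ zero) → inj₂ (inj₁ (inj₁ tt))
               ; (inj₂ (suc zero)) → inj₂ (inj₁ (inj₂ tt)) ; (inj₂ (suc (suc zero))) → inj₂ (inj₂ tt) })
            (λ { (inj₁ tt) → inj₁ tt ; (inj₂ (inj₁ (inj₁ tt))) → inj₂ zero
               ; (inj₂ (inj₁ (inj₂ tt))) → inj₂ (suc zero) ; (inj₂ (inj₂ tt)) → inj₂ (suc (suc zero)) })
            (λ { (inj₁ tt) → refl ; (inj₂ (inj₁ (inj₁ tt))) → refl ; (inj₂ (inj₁ (inj₂ tt))) → refl ; (inj₂ (inj₂ tt)) → refl })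
            (λ { (inj₁ tt) → refl ; (inj₂ zero) → refl ; (inj₂ (suc zero)) → refl ; (inj₂ (suc (suc zero))) → refl })

_[_≔_] : (t : SPTree) → Edgeᵀ ⟦ t ⟧ → SPTree → SPTree
K2      [ _      ≔ x ] = x
ser s t [ inj₁ e ≔ x ] = ser (s [ e ≔ x ]) t
ser s t [ inj₂ e ≔ x ] = ser s (t [ e ≔ x ])
par s t [ inj₁ e ≔ x ] = par (s [ e ≔ x ]) t
par s t [ inj₂ e ≔ x ] = par s (t [ e ≔ x ])

τᵀ-⟦⟧ : ∀ t ℓ → τᵀ ⟦ t ⟧ (decEdge t) ℓ ≈ ⟦ t [ ℓ ≔ dmt ] ⟧
τᵀ-⟦⟧ K2        tt       = τᵀ-K₂
τᵀ-⟦⟧ (ser s t) (inj₁ ℓ) = τᵀ-⊙ˡ ⟦ s ⟧ ⟦ t ⟧ (decEdge s) (decEdge t) ℓ ⨾ ⊙-cong (τᵀ-⟦⟧ s ℓ) ≈-refl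
τᵀ-⟦⟧ (ser s t) (inj₂ ℓ) = τᵀ-⊙ʳ ⟦ s ⟧ ⟦ t ⟧ (decEdge s) (decEdge t) ℓ ⨾ ⊙-cong ≈-refl (τᵀ-⟦⟧ t ℓ)
τᵀ-⟦⟧ (par s t) (inj₁ ℓ) = τᵀ-∥ˡ ⟦ s ⟧ ⟦ t ⟧ (decEdge s) (decEdge t) ℓ ⨾ ∥-cong (τᵀ-⟦⟧ s ℓ) ≈-refl
τᵀ-⟦⟧ (par s t) (inj₂ ℓ) = τᵀ-∥ʳ ⟦ s ⟧ ⟦ t ⟧ (decEdge s) (decEdge t) ℓ ⨾ ∥-cong ≈-refl (τᵀ-⟦⟧ t ℓ)

module ≃-Reasoning = Relation.Binary.Reasoning.Base.Single _≃_ ≃-refl ≃-trans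

tau-spGraph : ∀ t ℓ → asRooted (tau (spGraph t) (from (edgeFin t) ℓ)) ≃ asRooted (spGraph (t [ ℓ ≔ dmt ]))
tau-spGraph t ℓ = begin
  asRooted (tau (spGraph t) e)       ∼⟨ ≃-sym (τᴿ-asRooted (spGraph t) e) ⟩
  τᴿ (asRooted (spGraph t)) _≟_ e    ∼⟨ ≃-sym (τᴿ-cong (decEdge t) _≟_ (⟦⟧≃spGraph t) ℓ) ⟩
  τᴿ (toRooted ⟦ t ⟧) (decEdge t) ℓ  ∼⟨ τᴿ-toRooted ⟦ t ⟧ (decEdge t) ℓ ⟩
  toRooted (τᵀ ⟦ t ⟧ (decEdge t) ℓ)  ∼⟨ ≈⇒≃ (τᵀ-⟦⟧ t ℓ) ⟩
  toRooted ⟦ t [ ℓ ≔ dmt ] ⟧         ∼⟨ ⟦⟧≃spGraph (t [ ℓ ≔ dmt ]) ⟩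
  asRooted (spGraph (t [ ℓ ≔ dmt ])) ∎
  where
  open ≃-Reasoning
  e = from (edgeFin t) ℓ

-- Obtaining grown trees from D₃

Obtainable : SPTree → Set
Obtainable t = Σ RGraph λ H → TauReachable H × (asRooted H ≃ asRooted (spGraph t))

obtainable-D3 : Obtainable (par K2 (par K2 K2))
obtainable-D3 = D3 , start , record
  { vert↔ = ↔-refl ; edge↔ = ↔-refl ; root₀-pres = refl ; root₁-pres = refl
  ; endsᴿ-pres = λ { zero → inj₁ refl ; (suc zero) → inj₁ refl ; (suc (suc zero)) → inj₁ refl } }

obtainable-step : ∀ {t} → Obtainable t → ∀ ℓ → Obtainable (t [ ℓ ≔ dmt ])
obtainable-step {t} (H , H-reachable , f) ℓ = tau H eH , step H-reachable eH , (begin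
  asRooted (tau H eH)               ∼⟨ ≃-sym (τᴿ-asRooted H eH) ⟩
  τᴿ (asRooted H) _≟_ eH            ∼⟨ ≃-sym (τᴿ-cong _≟_ _≟_ (≃-sym f) e) ⟩
  τᴿ (asRooted (spGraph t)) _≟_ e   ∼⟨ τᴿ-asRooted (spGraph t) e ⟩
  asRooted (tau (spGraph t) e)      ∼⟨ tau-spGraph t ℓ ⟩
  asRooted (spGraph (t [ ℓ ≔ dmt ])) ∎)
  where
  open ≃-Reasoning
  e  = from (edgeFin t) ℓ
  eH = from (edge↔ f) e

Obtainable⇒ObtainableFromD3 : ∀ {t R} → Obtainable t → asRooted (spGraph t) ≃ asRooted R → ObtainableFromD3 R
Obtainable⇒ObtainableFromD3 (H , H-reachable , H≃t) t≃R = H , H-reachable , ≃⇒≅ (≃-trans H≃t t≃R)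

infix 4 _⟶_ _⇝_
data _⟶_ : SPTree → SPTree → Set where
  dmt-at : ∀ {t} ℓ → t ⟶ t [ ℓ ≔ dmt ]

_⇝_ : SPTree → SPTree → Set
_⇝_ = Star _⟶_

obtainable-⇝ : ∀ {t u} → Obtainable t → t ⇝ u → Obtainable u
obtainable-⇝     o ε                 = o
obtainable-⇝ {t} o (dmt-at ℓ ◅ rest) = obtainable-⇝ (obtainable-step {t} o ℓ) rest

module _ {s t : SPTree} where
  ⇝-serˡ : ∀ {s′} → s ⇝ s′ → ser s t ⇝ ser s′ t
  ⇝-serˡ = gmap (λ x → ser x t) λ { (dmt-at ℓ) → dmt-at (inj₁ ℓ) }
  ⇝-serʳ : ∀ {t′} → t ⇝ t′ → ser s t ⇝ ser s t′
  ⇝-serʳ = gmap (ser s) λ { (dmt-at ℓ) → dmt-at (inj₂ ℓ) }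
  ⇝-parˡ : ∀ {s′} → s ⇝ s′ → par s t ⇝ par s′ t
  ⇝-parˡ = gmap (λ x → par x t) λ { (dmt-at ℓ) → dmt-at (inj₁ ℓ) }
  ⇝-parʳ : ∀ {t′} → t ⇝ t′ → par s t ⇝ par s t′
  ⇝-parʳ = gmap (par s) λ { (dmt-at ℓ) → dmt-at (inj₂ ℓ) }

data Grown : SPTree → Set where
  base : Grown K2
  grow : ∀ {a b c d} → Grown a → Grown b → Grown c → Grown d → Grown (ser a (ser (par b c) d))

grown⇝ : ∀ {g} → Grown g → K2 ⇝ g
grown⇝ base = ε
grown⇝ (grow a b c d) = dmt-at tt ◅ (⇝-serˡ (grown⇝ a) ◅◅ ⇝-serʳ
  (⇝-serˡ (⇝-parˡ (grown⇝ b) ◅◅ ⇝-parʳ (grown⇝ c)) ◅◅ ⇝-serʳ (grown⇝ d)))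

obtainable-grown³ : ∀ {a b c} → Grown a → Grown b → Grown c → Obtainable (par a (par b c))
obtainable-grown³ a b c = obtainable-⇝ obtainable-D3
  (⇝-parˡ (grown⇝ a) ◅◅ ⇝-parʳ (⇝-parˡ (grown⇝ b) ◅◅ ⇝-parʳ (grown⇝ c)))

-- Degrees

count : {k : ℕ} → Fin k × Fin k → Fin k → ℕ
count (a , b) v = indicator (a ≟ v) + indicator (b ≟ v)

degreeOf : {k e : ℕ} → (Fin e → Fin k × Fin k) → Fin k → ℕ
degreeOf es v = ∑ (λ i → count (es i) v)

sumᴸ-tabulate : {k : ℕ} (f : Fin k → ℕ) → sumᴸ (tabulate f) ≡ ∑ f
sumᴸ-tabulate {zero}  f = refl
sumᴸ-tabulate {suc k} f = cong (f zero +_) (sumᴸ-tabulate (f ∘ suc))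

degree≡degreeOf : ∀ G v → degree G v ≡ degreeOf (ends G) v
degree≡degreeOf G v = trans (cong sumᴸ (map-tabulate id countAt)) (sumᴸ-tabulate countAt)
  where countAt = λ e → count (ends G e) v

∑-↑ : ∀ a {b} (f : Fin (a + b) → ℕ) → ∑ f ≡ ∑ (f ∘ (_↑ˡ b)) + ∑ (f ∘ (a ↑ʳ_))
∑-↑ zero    f = refl
∑-↑ (suc a) f = trans (cong (f zero +_) (∑-↑ a (f ∘ suc))) (sym (ℕ.+-assoc (f zero) _ _))

count-swap : {k : ℕ} (p : Fin k × Fin k) (v : Fin k) → count (swap p) v ≡ count p v
count-swap (a , b) v = ℕ.+-comm (indicator (b ≟ v)) (indicator (a ≟ v))

module _ {k k′ : ℕ} (h : Fin k → Fin k′) where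

  count-injective : Injective _≡_ _≡_ h → ∀ p x → count (map2 h p) (h x) ≡ count p x
  count-injective h-inj (a , b) x = cong₂ _+_ (same a) (same b)
    where
    same : ∀ a → indicator (h a ≟ h x) ≡ indicator (a ≟ x)
    same a with h a ≟ h x | a ≟ x
    ... | yes _   | yes _    = refl
    ... | yes eq  | no a≢x   = ⊥-elim (a≢x (h-inj eq))
    ... | no ha≢x | yes refl = ⊥-elim (ha≢x refl)
    ... | no _    | no _     = refl

  count-outside : ∀ {y} → (∀ z → h z ≢ y) → ∀ p → count (map2 h p) y ≡ 0
  count-outside {y} y∉h (a , b) = cong₂ _+_ (zero-at a) (zero-at b)
    where
    zero-at : ∀ a → indicator (h a ≟ y) ≡ 0
    zero-at a with h a ≟ y
    ... | yes eq = ⊥-elim (y∉h a eq)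
    ... | no _   = refl

  degreeOf-injective : Injective _≡_ _≡_ h → ∀ {e} (es : Fin e → Fin k × Fin k) x →
    degreeOf (map2 h ∘ es) (h x) ≡ degreeOf es x
  degreeOf-injective h-inj es x = sum-cong-≗ (λ i → count-injective h-inj (es i) x)

  degreeOf-outside : ∀ {y} → (∀ z → h z ≢ y) → ∀ {e} (es : Fin e → Fin k × Fin k) → degreeOf (map2 h ∘ es) y ≡ 0
  degreeOf-outside y∉h {e} es = trans (sum-cong-≗ (λ i → count-outside y∉h (es i))) (sum-replicate-zero e)

degreeOf-≃ : {R R′ : RGraph} (f : asRooted R ≃ asRooted R′) →
  ∀ v → degreeOf (ends (graph R′)) (to (vert↔ f) v) ≡ degreeOf (ends (graph R)) v
degreeOf-≃ {R} {R′} f v = trans (sum-permute _ (edge↔ f)) (sum-cong-≗ same)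
  where
  φ = to (vert↔ f)
  same : ∀ e → count (ends (graph R′) (to (edge↔ f) e)) (φ v) ≡ count (ends (graph R) e) v
  same e with endsᴿ-pres f e
  ... | inj₁ eq rewrite eq = count-injective φ (↔-injective (vert↔ f)) (ends (graph R) e) v
  ... | inj₂ eq rewrite eq = trans (count-swap (map2 φ (ends (graph R) e)) (φ v))
                                   (count-injective φ (↔-injective (vert↔ f)) (ends (graph R) e) v)

degreeOf-joinEnds : ∀ {k} a b (f : Fin a → Fin k × Fin k) (g : Fin b → Fin k × Fin k) v →
  degreeOf (joinEnds f g) v ≡ degreeOf f v + degreeOf g v
degreeOf-joinEnds a b f g v = trans (∑-↑ a _) (cong₂ _+_ (sum-cong-≗ left) (sum-cong-≗ right))
  where
  left : ∀ i → count (joinEnds f g (i ↑ˡ b)) v ≡ count (f i) v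
  left i rewrite splitAt-↑ˡ a i b = refl
  right : ∀ j → count (joinEnds f g (a ↑ʳ j)) v ≡ count (g j) v
  right j rewrite splitAt-↑ʳ a b j = refl

module _ {k k′ k″ a b : ℕ} {h : Fin k → Fin k″} {h′ : Fin k′ → Fin k″}
         (es : Fin a → Fin k × Fin k) (es′ : Fin b → Fin k′ × Fin k′) where

  private
    union = joinEnds (map2 h ∘ es) (map2 h′ ∘ es′)

  degreeOf-left : Injective _≡_ _≡_ h → ∀ x → (∀ z → h′ z ≢ h x) → degreeOf union (h x) ≡ degreeOf es x
  degreeOf-left h-inj x outside = trans (degreeOf-joinEnds a b _ _ (h x))
    (trans (cong₂ _+_ (degreeOf-injective h h-inj es x) (degreeOf-outside h′ outside es′)) (ℕ.+-identityʳ _))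

  degreeOf-right : Injective _≡_ _≡_ h′ → ∀ y → (∀ z → h z ≢ h′ y) → degreeOf union (h′ y) ≡ degreeOf es′ y
  degreeOf-right h′-inj y outside = trans (degreeOf-joinEnds a b _ _ (h′ y))
    (cong₂ _+_ (degreeOf-outside h outside es) (degreeOf-injective h′ h′-inj es′ y))

  degreeOf-shared : Injective _≡_ _≡_ h → Injective _≡_ _≡_ h′ → ∀ x y → h x ≡ h′ y →
    degreeOf union (h x) ≡ degreeOf es x + degreeOf es′ y
  degreeOf-shared h-inj h′-inj x y hx≡h′y = trans (degreeOf-joinEnds a b _ _ (h x))
    (cong₂ _+_ (degreeOf-injective h h-inj es x)
               (trans (cong (degreeOf (map2 h′ ∘ es′)) hx≡h′y) (degreeOf-injective h′ h′-inj es′ y)))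

↑ˡ≢↑ʳ : ∀ {a b} (i : Fin a) (j : Fin b) → i ↑ˡ b ≢ a ↑ʳ j
↑ˡ≢↑ʳ {a} {b} i j eq with trans (sym (splitAt-↑ˡ a i b)) (trans (cong (splitAt a) eq) (splitAt-↑ʳ a b j))
... | ()

module _ (ka kb : ℕ) where

  serL-injective : Injective _≡_ _≡_ (serL ka kb)
  serL-injective {zero}        {zero}        _  = refl
  serL-injective {suc zero}    {suc zero}    _  = refl
  serL-injective {suc (suc i)} {suc (suc j)} eq =
    cong (λ x → suc (suc x)) (↑ˡ-injective kb i j (suc-injective (suc-injective (suc-injective eq))))
  serL-injective {zero}        {suc zero}    ()
  serL-injective {zero}        {suc (suc _)} ()
  serL-injective {suc zero}    {zero}        ()
  serL-injective {suc zero}    {suc (suc _)} ()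
  serL-injective {suc (suc _)} {zero}        ()
  serL-injective {suc (suc _)} {suc zero}    ()

  serR-injective : Injective _≡_ _≡_ (serR ka kb)
  serR-injective {zero}        {zero}        _  = refl
  serR-injective {suc zero}    {suc zero}    _  = refl
  serR-injective {suc (suc i)} {suc (suc j)} eq =
    cong (λ x → suc (suc x)) (↑ʳ-injective ka i j (suc-injective (suc-injective (suc-injective eq))))
  serR-injective {zero}        {suc zero}    ()
  serR-injective {zero}        {suc (suc _)} ()
  serR-injective {suc zero}    {zero}        ()
  serR-injective {suc zero}    {suc (suc _)} ()
  serR-injective {suc (suc _)} {zero}        ()
  serR-injective {suc (suc _)} {suc zero}    ()

  parL-injective : Injective _≡_ _≡_ (parL ka kb)
  parL-injective {zero}        {zero}        _  = refl
  parL-injective {suc zero}    {suc zero}    _  = refl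
  parL-injective {suc (suc i)} {suc (suc j)} eq =
    cong (λ x → suc (suc x)) (↑ˡ-injective kb i j (suc-injective (suc-injective eq)))
  parL-injective {zero}        {suc zero}    ()
  parL-injective {zero}        {suc (suc _)} ()
  parL-injective {suc zero}    {zero}        ()
  parL-injective {suc zero}    {suc (suc _)} ()
  parL-injective {suc (suc _)} {zero}        ()
  parL-injective {suc (suc _)} {suc zero}    ()

  parR-injective : Injective _≡_ _≡_ (parR ka kb)
  parR-injective {zero}        {zero}        _  = refl
  parR-injective {suc zero}    {suc zero}    _  = refl
  parR-injective {suc (suc i)} {suc (suc j)} eq =
    cong (λ x → suc (suc x)) (↑ʳ-injective ka i j (suc-injective (suc-injective eq)))
  parR-injective {zero}        {suc zero}    ()
  parR-injective {zero}        {suc (suc _)} ()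
  parR-injective {suc zero}    {zero}        ()
  parR-injective {suc zero}    {suc (suc _)} ()
  parR-injective {suc (suc _)} {zero}        ()
  parR-injective {suc (suc _)} {suc zero}    ()

spDegree : ∀ t → Fin (suc (suc (internal t))) → ℕ
spDegree t = degreeOf (spEnds t)

sourceDegree sinkDegree : SPTree → ℕ
sourceDegree K2        = 1
sourceDegree (ser s t) = sourceDegree s
sourceDegree (par s t) = sourceDegree s + sourceDegree t
sinkDegree K2        = 1
sinkDegree (ser s t) = sinkDegree t
sinkDegree (par s t) = sinkDegree s + sinkDegree t

InnerCubic : SPTree → Set
InnerCubic K2        = ⊤
InnerCubic (ser s t) = InnerCubic s × InnerCubic t × sinkDegree s + sourceDegree t ≡ 3
InnerCubic (par s t) = InnerCubic s × InnerCubic t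

module _ (s t : SPTree) where
  private
    ka = internal s
    kb = internal t

  spDegree-serˡ : ∀ x → (∀ z → serR ka kb z ≢ serL ka kb x) → spDegree (ser s t) (serL ka kb x) ≡ spDegree s x
  spDegree-serˡ = degreeOf-left (spEnds s) (spEnds t) (serL-injective ka kb)

  spDegree-serʳ : ∀ y → (∀ z → serL ka kb z ≢ serR ka kb y) → spDegree (ser s t) (serR ka kb y) ≡ spDegree t y
  spDegree-serʳ = degreeOf-right (spEnds s) (spEnds t) (serR-injective ka kb)

  spDegree-parˡ : ∀ x → (∀ z → parR ka kb z ≢ parL ka kb x) → spDegree (par s t) (parL ka kb x) ≡ spDegree s x
  spDegree-parˡ = degreeOf-left (spEnds s) (spEnds t) (parL-injective ka kb)

  spDegree-parʳ : ∀ y → (∀ z → parL ka kb z ≢ parR ka kb y) → spDegree (par s t) (parR ka kb y) ≡ spDegree t y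
  spDegree-parʳ = degreeOf-right (spEnds s) (spEnds t) (parR-injective ka kb)

  spDegree-ser-middle : spDegree (ser s t) (suc (suc zero)) ≡ spDegree s (suc zero) + spDegree t zero
  spDegree-ser-middle = degreeOf-shared (spEnds s) (spEnds t) (serL-injective ka kb) (serR-injective ka kb) _ _ refl

  spDegree-par-source : spDegree (par s t) zero ≡ spDegree s zero + spDegree t zero
  spDegree-par-source = degreeOf-shared (spEnds s) (spEnds t) (parL-injective ka kb) (parR-injective ka kb) _ _ refl

  spDegree-par-sink : spDegree (par s t) (suc zero) ≡ spDegree s (suc zero) + spDegree t (suc zero)
  spDegree-par-sink = degreeOf-shared (spEnds s) (spEnds t) (parL-injective ka kb) (parR-injective ka kb) _ _ refl

spDegree-source : ∀ t → spDegree t zero ≡ sourceDegree t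
spDegree-sink   : ∀ t → spDegree t (suc zero) ≡ sinkDegree t
spDegree-source K2        = refl
spDegree-source (ser s t) =
  trans (spDegree-serˡ s t zero λ { zero () ; (suc zero) () ; (suc (suc _)) () }) (spDegree-source s)
spDegree-source (par s t) = trans (spDegree-par-source s t) (cong₂ _+_ (spDegree-source s) (spDegree-source t))
spDegree-sink K2        = refl
spDegree-sink (ser s t) =
  trans (spDegree-serʳ s t (suc zero) λ { zero () ; (suc zero) () ; (suc (suc _)) () }) (spDegree-sink t)
spDegree-sink (par s t) = trans (spDegree-par-sink s t) (cong₂ _+_ (spDegree-sink s) (spDegree-sink t))

innerCubic : ∀ t → (∀ i → spDegree t (suc (suc i)) ≡ 3) → InnerCubic t
innerCubic K2        _     = tt
innerCubic (ser s t) deg≡3 = innerCubic s inner-s , innerCubic t inner-t , middle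
  where
  inner-s : ∀ i → spDegree s (suc (suc i)) ≡ 3
  inner-s i = trans (sym (spDegree-serˡ s t (suc (suc i)) λ
    { zero () ; (suc zero) () ; (suc (suc j)) eq → ↑ˡ≢↑ʳ i j (sym (suc-injective (suc-injective (suc-injective eq)))) }))
    (deg≡3 (suc (i ↑ˡ internal t)))
  inner-t : ∀ j → spDegree t (suc (suc j)) ≡ 3
  inner-t j = trans (sym (spDegree-serʳ s t (suc (suc j)) λ
    { zero () ; (suc zero) () ; (suc (suc i)) eq → ↑ˡ≢↑ʳ i j (suc-injective (suc-injective (suc-injective eq))) }))
    (deg≡3 (suc (internal s ↑ʳ j)))
  middle : sinkDegree s + sourceDegree t ≡ 3
  middle = trans (sym (cong₂ _+_ (spDegree-sink s) (spDegree-source t)))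
                 (trans (sym (spDegree-ser-middle s t)) (deg≡3 zero))
innerCubic (par s t) deg≡3 = innerCubic s inner-s , innerCubic t inner-t
  where
  inner-s : ∀ i → spDegree s (suc (suc i)) ≡ 3
  inner-s i = trans (sym (spDegree-parˡ s t (suc (suc i)) λ
    { zero () ; (suc zero) () ; (suc (suc j)) eq → ↑ˡ≢↑ʳ i j (sym (suc-injective (suc-injective eq))) }))
    (deg≡3 (i ↑ˡ internal t))
  inner-t : ∀ j → spDegree t (suc (suc j)) ≡ 3
  inner-t j = trans (sym (spDegree-parʳ s t (suc (suc j)) λ
    { zero () ; (suc zero) () ; (suc (suc i)) eq → ↑ˡ≢↑ʳ i j (suc-injective (suc-injective eq)) }))
    (deg≡3 (internal s ↑ʳ j))

record Cubic[_,_]_ (i j : ℕ) (t : SPTree) : Set where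
  constructor cubic
  field
    source-degree : sourceDegree t ≡ i
    sink-degree   : sinkDegree t ≡ j
    inner-cubic   : InnerCubic t

spGraph-cubic : ∀ t → Cubic (graph (spGraph t)) → Cubic[ 3 , 3 ] t
spGraph-cubic t cubic-t = cubic (trans (sym (spDegree-source t)) (deg≡3 zero))
                                (trans (sym (spDegree-sink t)) (deg≡3 (suc zero)))
                                (innerCubic t (λ i → deg≡3 (suc (suc i))))
  where
  deg≡3 : ∀ v → spDegree t v ≡ 3
  deg≡3 v = trans (sym (degree≡degreeOf (graph (spGraph t)) v)) (cubic-t v)

-- Normal forms of cubic series-parallel trees

sourceDegree-positive : ∀ t → 1 ≤ sourceDegree t
sourceDegree-positive K2        = ℕ.≤-refl
sourceDegree-positive (ser s t) = sourceDegree-positive s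
sourceDegree-positive (par s t) = ℕ.≤-trans (sourceDegree-positive s) (ℕ.m≤m+n _ _)

sinkDegree-positive : ∀ t → 1 ≤ sinkDegree t
sinkDegree-positive K2        = ℕ.≤-refl
sinkDegree-positive (ser s t) = sinkDegree-positive t
sinkDegree-positive (par s t) = ℕ.≤-trans (sinkDegree-positive s) (ℕ.m≤m+n _ _)

positive-sum≡3 : ∀ {x y} → 1 ≤ x → 1 ≤ y → x + y ≡ 3 → (x ≡ 1 × y ≡ 2) ⊎ (x ≡ 2 × y ≡ 1)
positive-sum≡3 {1} {2} _ _ _ = inj₁ (refl , refl)
positive-sum≡3 {2} {1} _ _ _ = inj₂ (refl , refl)
positive-sum≡3 {1} {1}                   _ _ ()
positive-sum≡3 {1} {suc (suc (suc _))}   _ _ ()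
positive-sum≡3 {2} {suc (suc _)}         _ _ ()
positive-sum≡3 {3} {suc _}                 _ _ ()
positive-sum≡3 {suc (suc (suc (suc _)))} {suc _} _ _ ()

positive-sum≡2 : ∀ {x y} → 1 ≤ x → 1 ≤ y → x + y ≡ 2 → x ≡ 1 × y ≡ 1
positive-sum≡2 {1} {1} _ _ _ = refl , refl
positive-sum≡2 {1} {suc (suc _)} _ _ ()
positive-sum≡2 {2} {suc _} _ _ ()
positive-sum≡2 {suc (suc (suc _))} {suc _} _ _ ()

positive-sum≢1 : ∀ {x y} → 1 ≤ x → 1 ≤ y → x + y ≢ 1
positive-sum≢1 {1} {suc _} _ _ ()
positive-sum≢1 {suc (suc _)} {suc _} _ _ ()

Cubic-ser : ∀ {s t i j k k′} → Cubic[ i , k ] s → Cubic[ k′ , j ] t → k + k′ ≡ 3 → Cubic[ i , j ] (ser s t)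
Cubic-ser (cubic refl refl cs) (cubic refl refl ct) mid = cubic refl refl (cs , ct , mid)

Cubic-par : ∀ {s t i j i′ j′} → Cubic[ i , j ] s → Cubic[ i′ , j′ ] t → Cubic[ i + i′ , j + j′ ] (par s t)
Cubic-par (cubic refl refl cs) (cubic refl refl ct) = cubic refl refl (cs , ct)

Cubic-reverse : ∀ {t i j} → Cubic[ i , j ] t → Cubic[ j , i ] (reverse t)
Cubic-reverse {K2}      (cubic refl refl _)             = cubic refl refl tt
Cubic-reverse {ser s t} (cubic refl refl (cs , ct , mid)) =
  Cubic-ser (Cubic-reverse (cubic refl refl ct)) (Cubic-reverse (cubic refl refl cs))
            (trans (ℕ.+-comm (sourceDegree t) (sinkDegree s)) mid)
Cubic-reverse {par s t} (cubic refl refl (cs , ct)) =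
  Cubic-par (Cubic-reverse (cubic refl refl cs)) (Cubic-reverse (cubic refl refl ct))

grown-cubic : ∀ {g} → Grown g → Cubic[ 1 , 1 ] g
grown-cubic base           = cubic refl refl tt
grown-cubic (grow a b c d) =
  Cubic-ser (grown-cubic a) (Cubic-ser (Cubic-par (grown-cubic b) (grown-cubic c)) (grown-cubic d) refl) refl

data SerSplit (i j : ℕ) (s t : SPTree) : Set where
  1∣2 : Cubic[ i , 1 ] s → Cubic[ 2 , j ] t → SerSplit i j s t
  2∣1 : Cubic[ i , 2 ] s → Cubic[ 1 , j ] t → SerSplit i j s t

serSplit : ∀ {i j s t} → Cubic[ i , j ] (ser s t) → SerSplit i j s t
serSplit {s = s} {t} (cubic src snk (cs , ct , mid))
  with positive-sum≡3 (sinkDegree-positive s) (sourceDegree-positive t) mid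
... | inj₁ (k , k′) = 1∣2 (cubic src k cs) (cubic k′ snk ct)
... | inj₂ (k , k′) = 2∣1 (cubic src k cs) (cubic k′ snk ct)

par-source≢1 : ∀ {j s t} → ¬ Cubic[ 1 , j ] (par s t)
par-source≢1 {s = s} {t} (cubic src _ _) = positive-sum≢1 (sourceDegree-positive s) (sourceDegree-positive t) src

par-sink≢1 : ∀ {i s t} → ¬ Cubic[ i , 1 ] (par s t)
par-sink≢1 {s = s} {t} (cubic _ snk _) = positive-sum≢1 (sinkDegree-positive s) (sinkDegree-positive t) snk

par₂₂-split : ∀ {s t} → Cubic[ 2 , 2 ] (par s t) → Cubic[ 1 , 1 ] s × Cubic[ 1 , 1 ] t
par₂₂-split {s} {t} (cubic src snk (cs , ct))
  with positive-sum≡2 (sourceDegree-positive s) (sourceDegree-positive t) src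
     | positive-sum≡2 (sinkDegree-positive s) (sinkDegree-positive t) snk
... | s₁ , t₁ | s₁′ , t₁′ = cubic s₁ s₁′ cs , cubic t₁ t₁′ ct

data Shape : ℕ → ℕ → SPTree → Set where
  grown           : ∀ {g} → Grown g → Shape 1 1 g
  grown⊙pair      : ∀ {g g₁ g₂} → Grown g → Grown g₁ → Grown g₂ → Shape 1 2 (ser g (par g₁ g₂))
  pair⊙grown      : ∀ {g₁ g₂ g} → Grown g₁ → Grown g₂ → Grown g → Shape 2 1 (ser (par g₁ g₂) g)
  pair            : ∀ {g₁ g₂} → Grown g₁ → Grown g₂ → Shape 2 2 (par g₁ g₂)
  pair⊙grown⊙pair : ∀ {g₁ g₂ g g₃ g₄} → Grown g₁ → Grown g₂ → Grown g → Grown g₃ → Grown g₄ →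
                    Shape 2 2 (ser (par g₁ g₂) (ser g (par g₃ g₄)))

Normal : ℕ → ℕ → SPTree → Set
Normal i j t = Σ SPTree λ u → Shape i j u × ⟦ u ⟧ ≈ ⟦ t ⟧

-- A series junction splits its degree 3 as 1 + 2 or 2 + 1, and a parallel composition with root
-- degrees at most 2 has both parts of type (1, 1); associativity regroups the pieces into a `Shape`.
normal₁₁ : ∀ t → Cubic[ 1 , 1 ] t → Normal 1 1 t
normal₁₂ : ∀ t → Cubic[ 1 , 2 ] t → Normal 1 2 t
normal₂₁ : ∀ t → Cubic[ 2 , 1 ] t → Normal 2 1 t
normal₂₂ : ∀ t → Cubic[ 2 , 2 ] t → Normal 2 2 t

normal₁₁ K2        _ = K2 , grown base , ≈-refl
normal₁₁ (par s t) c = ⊥-elim (par-source≢1 c)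
normal₁₁ (ser s t) c with serSplit c
... | 1∣2 cs ct with normal₁₁ s cs | normal₂₁ t ct
...   | _ , grown g , i | _ , pair⊙grown g₁ g₂ g′ , j = _ , grown (grow g g₁ g₂ g′) , ⊙-cong i j
normal₁₁ (ser s t) c | 2∣1 cs ct with normal₁₂ s cs | normal₁₁ t ct
...   | _ , grown⊙pair g g₁ g₂ , i | _ , grown g′ , j = _ , grown (grow g g₁ g₂ g′) , ≈-sym ⊙-assoc ⨾ ⊙-cong i j

normal₁₂ K2        (cubic _ () _)
normal₁₂ (par s t) c = ⊥-elim (par-source≢1 c)
normal₁₂ (ser s t) c with serSplit c
... | 1∣2 cs ct with normal₁₁ s cs | normal₂₂ t ct
...   | _ , grown g , i | _ , pair g₁ g₂ , j = _ , grown⊙pair g g₁ g₂ , ⊙-cong i j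
...   | _ , grown g , i | _ , pair⊙grown⊙pair h₁ h₂ h h₃ h₄ , j =
  _ , grown⊙pair (grow g h₁ h₂ h) h₃ h₄ , ⊙-assoc ⨾ ⊙-cong ≈-refl ⊙-assoc ⨾ ⊙-cong i j
normal₁₂ (ser s t) c | 2∣1 cs ct with normal₁₂ s cs | normal₁₂ t ct
...   | _ , grown⊙pair g g₁ g₂ , i | _ , grown⊙pair g′ g₁′ g₂′ , j =
  _ , grown⊙pair (grow g g₁ g₂ g′) g₁′ g₂′ , ⊙-assoc ⨾ ⊙-cong ≈-refl ⊙-assoc ⨾ ≈-sym ⊙-assoc ⨾ ⊙-cong i j

normal₂₁ K2        (cubic () _ _)
normal₂₁ (par s t) c = ⊥-elim (par-sink≢1 c)
normal₂₁ (ser s t) c with serSplit c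
... | 1∣2 cs ct with normal₂₁ s cs | normal₂₁ t ct
...   | _ , pair⊙grown g₁ g₂ g , i | _ , pair⊙grown g₁′ g₂′ g′ , j =
  _ , pair⊙grown g₁ g₂ (grow g g₁′ g₂′ g′) , ≈-sym ⊙-assoc ⨾ ⊙-cong i j
normal₂₁ (ser s t) c | 2∣1 cs ct with normal₂₂ s cs | normal₁₁ t ct
...   | _ , pair g₁ g₂ , i | _ , grown g , j = _ , pair⊙grown g₁ g₂ g , ⊙-cong i j
...   | _ , pair⊙grown⊙pair h₁ h₂ h h₃ h₄ , i | _ , grown g , j =
  _ , pair⊙grown h₁ h₂ (grow h h₃ h₄ g) , ⊙-cong ≈-refl (≈-sym ⊙-assoc) ⨾ ≈-sym ⊙-assoc ⨾ ⊙-cong i j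

normal₂₂ K2        (cubic () _ _)
normal₂₂ (par s t) c with par₂₂-split c
... | cs , ct with normal₁₁ s cs | normal₁₁ t ct
...   | _ , grown g , i | _ , grown g′ , j = _ , pair g g′ , ∥-cong i j
normal₂₂ (ser s t) c with serSplit c
... | 1∣2 cs ct with normal₂₁ s cs | normal₂₂ t ct
...   | _ , pair⊙grown g₁ g₂ g , i | _ , pair g₃ g₄ , j =
  _ , pair⊙grown⊙pair g₁ g₂ g g₃ g₄ , ≈-sym ⊙-assoc ⨾ ⊙-cong i j
...   | _ , pair⊙grown g₁ g₂ g , i | _ , pair⊙grown⊙pair h₁ h₂ h h₃ h₄ , j =
  _ , pair⊙grown⊙pair g₁ g₂ (grow g h₁ h₂ h) h₃ h₄
    , ⊙-cong ≈-refl (⊙-assoc ⨾ ⊙-cong ≈-refl ⊙-assoc) ⨾ ≈-sym ⊙-assoc ⨾ ⊙-cong i j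
normal₂₂ (ser s t) c | 2∣1 cs ct with normal₂₂ s cs | normal₁₂ t ct
...   | _ , pair g₁ g₂ , i | _ , grown⊙pair g g₃ g₄ , j = _ , pair⊙grown⊙pair g₁ g₂ g g₃ g₄ , ⊙-cong i j
...   | _ , pair⊙grown⊙pair h₁ h₂ h h₃ h₄ , i | _ , grown⊙pair g g₃ g₄ , j =
  _ , pair⊙grown⊙pair h₁ h₂ (grow h h₃ h₄ g) g₃ g₄
    , ⊙-cong ≈-refl (⊙-assoc ⨾ ⊙-cong ≈-refl ⊙-assoc ⨾ ≈-sym ⊙-assoc) ⨾ ≈-sym ⊙-assoc ⨾ ⊙-cong i j

-- Re-rooting into three grown trees

record GrownTriple (t : SPTree) : Set where
  field
    {g₁ g₂ g₃}    : SPTree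
    grown₁        : Grown g₁
    grown₂        : Grown g₂
    grown₃        : Grown g₃
    source′ sink′ : Vertex (Inner ⟦ t ⟧)
    triple≃       : toRooted ⟦ par g₁ (par g₂ g₃) ⟧ ≃ rerooted (toRooted ⟦ t ⟧) source′ sink′

GrownTriple-≈ : ∀ {t t′} → ⟦ t ⟧ ≈ ⟦ t′ ⟧ → GrownTriple t → GrownTriple t′
GrownTriple-≈ f T = record
  { grown₁ = grown₁ ; grown₂ = grown₂ ; grown₃ = grown₃
  ; triple≃ = ≃-trans triple≃ (reroot (≈⇒≃ f) source′ sink′) }
  where open GrownTriple T

triple-by-pivot : ∀ {a b g₁ g₂} r → Grown g₁ → Grown g₂ → ⟦ ser (par g₁ g₂) r ⟧ ≈ ⟦ b ⟧ →
  Cubic[ 1 , 1 ] ser a (reverse r) → GrownTriple (par a b)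
triple-by-pivot {a} r grown₁ grown₂ b≈ c with normal₁₁ (ser a (reverse r)) c
... | _ , grown grown₃ , i = record
  { grown₁ = grown₁ ; grown₂ = grown₂ ; grown₃ = grown₃
  ; triple≃ = ≃-trans (≈⇒≃ (≈-sym ∥-assoc ⨾ ∥-cong ≈-refl i))
                (≃-trans (pivot (reverse-≈ʳ r))
                  (reroot (≈⇒≃ (∥-cong ≈-refl b≈)) source (parallelʳ (seriesˡ sink)))) }

triple₁₁₂₂ : ∀ {a b} → Cubic[ 1 , 1 ] a → Cubic[ 2 , 2 ] b → GrownTriple (par a b)
triple₁₁₂₂ {a} {b} ca cb with normal₁₁ a ca | normal₂₂ b cb
... | _ , grown g , i | _ , pair g₁ g₂ , j = record
  { grown₁ = g ; grown₂ = g₁ ; grown₃ = g₂ ; triple≃ = ≈⇒≃ (∥-cong i j) }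
... | _ , grown g , i | _ , pair⊙grown⊙pair {g = h} {g₃} {g₄} g₁ g₂ gh g₃′ g₄′ , j =
  triple-by-pivot (ser h (par g₃ g₄)) g₁ g₂ j
    (Cubic-ser ca (Cubic-reverse
      (Cubic-ser (grown-cubic gh) (Cubic-par (grown-cubic g₃′) (grown-cubic g₄′)) refl)) refl)

triple₁₂₂₁ : ∀ {a b} → Cubic[ 1 , 2 ] a → Cubic[ 2 , 1 ] b → GrownTriple (par a b)
triple₁₂₂₁ {b = b} ca cb with normal₂₁ b cb
... | _ , pair⊙grown {g = g} g₁ g₂ gg , j =
  triple-by-pivot g g₁ g₂ j (Cubic-ser ca (Cubic-reverse (grown-cubic gg)) refl)

cubic-par-triple : ∀ {a b} → Cubic[ 3 , 3 ] par a b → GrownTriple (par a b)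
cubic-par-triple {a} {b} (cubic src snk (ca , cb))
  with positive-sum≡3 (sourceDegree-positive a) (sourceDegree-positive b) src
     | positive-sum≡3 (sinkDegree-positive a) (sinkDegree-positive b) snk
... | inj₁ (a₁ , b₂) | inj₁ (a₁′ , b₂′) = triple₁₁₂₂ (cubic a₁ a₁′ ca) (cubic b₂ b₂′ cb)
... | inj₂ (a₂ , b₁) | inj₂ (a₂′ , b₁′) = GrownTriple-≈ ∥-comm (triple₁₁₂₂ (cubic b₁ b₁′ cb) (cubic a₂ a₂′ ca))
... | inj₁ (a₁ , b₂) | inj₂ (a₂ , b₁)   = triple₁₂₂₁ (cubic a₁ a₂ ca) (cubic b₂ b₁ cb)
... | inj₂ (a₂ , b₁) | inj₁ (a₁ , b₂)   = GrownTriple-≈ ∥-comm (triple₁₂₂₁ (cubic b₁ b₂ cb) (cubic a₂ a₁ ca))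

-- Isomorphism invariance and biconnectivity

module _ {R R′ : RGraph} (f : asRooted R ≃ asRooted R′) where
  private
    φ = to (vert↔ f)

  Joins-≃ : ∀ {e u w} → Joins (graph R) e u w → Joins (graph R′) (to (edge↔ f) e) (φ u) (φ w)
  Joins-≃ {e} j with endsᴿ-pres f e | j
  ... | inj₁ p | inj₁ refl = inj₁ p
  ... | inj₁ p | inj₂ refl = inj₂ p
  ... | inj₂ p | inj₁ refl = inj₂ p
  ... | inj₂ p | inj₂ refl = inj₁ p

  Walk-≃ : ∀ {ok ok′} → (∀ w → ok w → ok′ (φ w)) → ∀ {u v} → Walk (graph R) ok u v → Walk (graph R′) ok′ (φ u) (φ v)
  Walk-≃ ok⇒ok′ (here o)          = here (ok⇒ok′ _ o)
  Walk-≃ ok⇒ok′ (step e j o rest) = step (to (edge↔ f) e) (Joins-≃ j) (ok⇒ok′ _ o) (Walk-≃ ok⇒ok′ rest)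

  Cubic-≃ : Cubic (graph R′) → Cubic (graph R)
  Cubic-≃ deg≡3 v = begin
    degree (graph R) v           ≡⟨ degree≡degreeOf (graph R) v ⟩
    degreeOf (ends (graph R)) v  ≡⟨ degreeOf-≃ f v ⟨
    degreeOf (ends (graph R′)) (φ v) ≡⟨ degree≡degreeOf (graph R′) (φ v) ⟨
    degree (graph R′) (φ v)      ≡⟨ deg≡3 (φ v) ⟩
    3                            ∎
    where open ≡-Reasoning

Biconnected-≃ : {R R′ : RGraph} → asRooted R ≃ asRooted R′ → Biconnected (graph R′) → Biconnected (graph R)
Biconnected-≃ {R} {R′} f (connected , avoiding) =
  (λ u v → pull (λ _ _ → tt) (connected (φ u) (φ v)))
  , λ x u v u≢x v≢x → pull (λ w w≢φx w′≡x → w≢φx (trans (sym (strictlyInverseˡ (vert↔ f) w)) (cong φ w′≡x)))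
      (avoiding (φ x) (φ u) (φ v) (u≢x ∘ ↔-injective (vert↔ f)) (v≢x ∘ ↔-injective (vert↔ f)))
  where
  φ = to (vert↔ f)
  pull : ∀ {ok ok′ u v} → (∀ w → ok′ w → ok (from (vert↔ f) w)) →
         Walk (graph R′) ok′ (φ u) (φ v) → Walk (graph R) ok u v
  pull {ok} {u = u} {v} ok′⇒ok w = subst₂ (Walk (graph R) ok)
    (strictlyInverseʳ (vert↔ f) u) (strictlyInverseʳ (vert↔ f) v) (Walk-≃ (≃-sym f) ok′⇒ok w)

module _ (s t : SPTree) where
  private
    ka = internal s
    kb = internal t
    G = graph (spGraph (ser s t))
    middle : Fin (suc (suc (internal (ser s t))))
    middle = suc (suc zero)

    OnLeft : Fin (suc (suc (internal (ser s t)))) → Set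
    OnLeft u = Σ (Fin (suc (suc ka))) λ x → serL ka kb x ≡ u

    shared⇒middle : ∀ x y → serL ka kb x ≡ serR ka kb y → serL ka kb x ≡ middle
    shared⇒middle (suc zero)    _             _  = refl
    shared⇒middle (suc (suc i)) (suc (suc j)) eq =
      ⊥-elim (↑ˡ≢↑ʳ i j (suc-injective (suc-injective (suc-injective eq))))
    shared⇒middle zero          zero          ()
    shared⇒middle zero          (suc zero)    ()
    shared⇒middle zero          (suc (suc _)) ()
    shared⇒middle (suc (suc _)) zero          ()
    shared⇒middle (suc (suc _)) (suc zero)    ()

    Side : Fin (nedges (ser s t)) → Set
    Side e = (Σ _ λ i → ends G e ≡ map2 (serL ka kb) (spEnds s i))
           ⊎ (Σ _ λ j → ends G e ≡ map2 (serR ka kb) (spEnds t j))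

    side-of : ∀ e x → splitAt (nedges s) e ≡ x → Side e
    side-of e (inj₁ i) eq = inj₁ (i , trans (cong (spEnds (ser s t)) (sym (splitAt⁻¹-↑ˡ eq))) (spEnds-serˡ s t i))
    side-of e (inj₂ j) eq = inj₂ (j , trans (cong (spEnds (ser s t)) (sym (splitAt⁻¹-↑ʳ eq))) (spEnds-serʳ s t j))

    side : ∀ e → Side e
    side e = side-of e _ refl

    step-stays-left : ∀ {e x w} → Joins G e (serL ka kb x) w → serL ka kb x ≢ middle → OnLeft w
    step-stays-left {e} j ≢middle with side e | j
    ... | inj₁ (i , eq) | inj₁ ends≡ = proj₂ (spEnds s i) , cong proj₂ (trans (sym eq) ends≡)
    ... | inj₁ (i , eq) | inj₂ ends≡ = proj₁ (spEnds s i) , cong proj₁ (trans (sym eq) ends≡)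
    ... | inj₂ (j , eq) | inj₁ ends≡ = ⊥-elim (≢middle (shared⇒middle _ _ (sym (cong proj₁ (trans (sym eq) ends≡)))))
    ... | inj₂ (j , eq) | inj₂ ends≡ = ⊥-elim (≢middle (shared⇒middle _ _ (sym (cong proj₂ (trans (sym eq) ends≡)))))

    walk-stays-left : ∀ {u v} → Walk G (_≢ middle) u v → OnLeft u → OnLeft v
    walk-stays-left (here _)          left       = left
    walk-stays-left (step e j o rest) (x , refl) = walk-stays-left rest (step-stays-left j o)

  -- The junction of a series composition separates its source from its sink.
  ser-not-biconnected : ¬ Biconnected G
  ser-not-biconnected (_ , avoiding) with walk-stays-left (avoiding middle zero (suc zero) (λ ()) (λ ())) (zero , refl)
  ... | zero , ()
  ... | suc zero , ()
  ... | suc (suc _) , ()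

GrownTriple⇒obtainable : ∀ {G p₀ q₀ t} → asRooted (spGraph t) ≃ asRooted (rooted G p₀ q₀) → GrownTriple t →
  Σ (Fin (n G)) λ p → Σ (Fin (n G)) λ q → IsTTSP (rooted G p q) × ObtainableFromD3 (rooted G p q)
GrownTriple⇒obtainable {G} {t = t} f T =
  p , q , (triple , ≃⇒≅ triple≃G)
  , Obtainable⇒ObtainableFromD3 {triple} (obtainable-grown³ grown₁ grown₂ grown₃) triple≃G
  where
  open GrownTriple T
  triple = par g₁ (par g₂ g₃)
  ψ = ≃-trans (⟦⟧≃spGraph t) f
  p = to (vert↔ ψ) source′
  q = to (vert↔ ψ) sink′
  triple≃G : asRooted (spGraph triple) ≃ asRooted (rooted G p q)
  triple≃G = ≃-trans (≃-sym (⟦⟧≃spGraph triple)) (≃-trans triple≃ (reroot ψ source′ sink′))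

theorem2p5 : (G : Graph) → Loopless G → Connected G → Biconnected G → Cubic G → SeriesParallel G →
    Σ (Fin (n G)) λ p → Σ (Fin (n G)) λ q → IsTTSP (rooted G p q) × ObtainableFromD3 (rooted G p q)
theorem2p5 G _ _ biconnected cubic-G (p₀ , q₀ , t , t≅G) = decompose t (≅⇒≃ t≅G)
  where
  decompose : ∀ t → asRooted (spGraph t) ≃ asRooted (rooted G p₀ q₀) →
    Σ (Fin (n G)) λ p → Σ (Fin (n G)) λ q → IsTTSP (rooted G p q) × ObtainableFromD3 (rooted G p q)
  decompose t f with spGraph-cubic t (Cubic-≃ f cubic-G)
  decompose K2        f | cubic () _ _
  decompose (ser s t) f | _ = ⊥-elim (ser-not-biconnected s t (Biconnected-≃ f biconnected))
  decompose (par a b) f | c = GrownTriple⇒obtainable f (cubic-par-triple c)
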